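{- For every $n\geq 3$, \[ \mathrm{La}(n,N,\#P_2)=\mathrm{La}(n,\mathcal{P}_4,\#P_2)=\binom{n}{\lfloor n/2\rfloor}. \]
   Context: $2^{[n]}$ is the Boolean lattice of all subsets of $[n]=\{1,\dots,n\}$ ordered by inclusion. A poset $P$ is a (weak) subposet of a poset $Q$ if there is an injection $f:P\to Q$ such that $p\le_P p'$ implies $f(p)\le_Q f(p')$. For a poset or a family of posets, a family $\mathcal{F}\subseteq 2^{[n]}$ is free of it if no poset in question is a weak subposet of $(\mathcal{F},\subseteq)$. $P_2$ is the 2-element chain; a copy of $P_2$ in $\mathcal{F}$ is a pair $F\subsetneq F'$ with $F,F'\in\mathcal{F}$. $\mathrm{La}(n,P,\#P_2)$ (where $P$ is a poset or a family of posets) is the maximum number of copies of $P_2$ in a $P$-free family $\mathcal{F}\subseteq 2^{[n]}$. The poset $N$ consists of four distinct elements $p_1,p_2,q_1,q_2$ with $p_1<q_1$, $p_2<q_1$, $p_2<q_2$. $\mathcal{P}_k$ denotes the family of all posets on $k$ elements whose undirected Hasse diagram is a path. -}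

module Defs where

open import Data.Nat using (ℕ; _≤_)
open import Data.Bool using (Bool; true; false)
open import Data.Fin using (Fin; zero; suc; inject₁)
open import Data.Fin.Subset using (Subset; _⊆_)
open import Data.Fin.Subset.Properties using (_⊂?_)
open import Data.Vec using (Vec; lookup)
open import Data.List using (List; length; filter; cartesianProduct)
open import Data.List.Relation.Unary.Unique.Propositional using (Unique)
import Data.List.Membership.Propositional as LM
open import Data.Product using (Σ; _×_; _,_; proj₁; proj₂)
open import Data.Sum using (_⊎_)
open import Relation.Nullary using (¬_)
open import Relation.Binary.PropositionalEquality using (_≡_)
open import Relation.Binary.Construct.Closure.ReflexiveTransitive using (Star)
open import Function.Definitions using (Injective)

-- A family of subsets of [n] is a duplicate-free list of elements of 2^[n].
-- Number of copies of P₂ in F: ordered pairs (A , B) of members with A ⊊ B.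
#P₂ : ∀ {n} → List (Subset n) → ℕ
#P₂ F = length (filter (λ p → proj₁ p ⊂? proj₂ p) (cartesianProduct F F))

WeakSubposet : ∀ {k n} → (Fin k → Fin k → Set) → List (Subset n) → Set
WeakSubposet {k} {n} _≤P_ F =
  Σ (Fin k → Subset n) λ f →
    Injective _≡_ _≡_ f × (∀ i → f i LM.∈ F) × (∀ i j → i ≤P j → f i ⊆ f j)

-- The poset N on {p₁ , p₂ , q₁ , q₂} = {0 , 1 , 2 , 3}:
-- p₁ < q₁ , p₂ < q₁ , p₂ < q₂ (plus reflexivity; already transitive).
N≤ : Fin 4 → Fin 4 → Set
N≤ a b = a ≡ b
       ⊎ (a ≡ zero × b ≡ suc (suc zero))
       ⊎ (a ≡ suc zero × b ≡ suc (suc zero))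
       ⊎ (a ≡ suc zero × b ≡ suc (suc (suc zero)))

-- Posets on 4 elements whose Hasse diagram is a path: the path 0 - 1 - 2 - 3,
-- with edge i (between i and i+1) oriented upward (i < i+1) if o[i] = true
-- and downward (i+1 < i) if o[i] = false; the order is the
-- reflexive-transitive closure of the oriented edges.
PathEdge : Vec Bool 3 → Fin 4 → Fin 4 → Set
PathEdge o a b = Σ (Fin 3) λ i →
    (lookup o i ≡ true  × a ≡ inject₁ i × b ≡ suc i)
  ⊎ (lookup o i ≡ false × a ≡ suc i × b ≡ inject₁ i)

Path≤ : Vec Bool 3 → Fin 4 → Fin 4 → Set
Path≤ o = Star (PathEdge o)

N-free : ∀ {n} → List (Subset n) → Set
N-free F = ¬ WeakSubposet N≤ F

𝒫₄-free : ∀ {n} → List (Subset n) → Set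
𝒫₄-free F = ∀ (o : Vec Bool 3) → ¬ WeakSubposet (Path≤ o) F

La#P₂≡ : (n : ℕ) → (List (Subset n) → Set) → ℕ → Set
La#P₂≡ n Free m =
    (∀ (F : List (Subset n)) → Unique F → Free F → #P₂ F ≤ m)
  × Σ (List (Subset n)) (λ F → Unique F × Free F × #P₂ F ≡ m)

module Submission where

-- Count maximal chains of 2^[n]; there are n! of them. A set of size a lies on
-- a! (n - a)! ≥ ⌊n/2⌋! ⌈n/2⌉! of them, and (for n ≥ 3) an interval [a , c] with
-- ∣c∣ ≥ ∣a∣ + 2 is met by at least three times as many. Take a minimal member x of an
-- N-free family. Either x ⊂ y ⊂ z, and then y and z are the only members above x, so the
-- members containing x carry at most three comparable pairs; or the members above x are
-- maximal, and the members containing x (or, if exactly one member lies above x, those below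
-- it) form a star: a centre and an antichain of leaves, one comparable pair per leaf.
-- This part is incomparable with the rest of the family, so the convex hulls of the
-- successive parts meet disjoint sets of chains, whence ⌊n/2⌋! ⌈n/2⌉! · #P₂ ≤ n!, that is,
-- #P₂ ≤ binom(n , ⌊n/2⌋). Equality holds for ∅ together with the middle level, which
-- contains neither N nor a 4-element path.

open import Defs

open import Data.Bool using (Bool; true; false; T; _∧_; _∨_; not; if_then_else_)
open import Data.Bool.ListAction using (any)
open import Data.Bool.Properties using (∨-identityʳ; ∨-comm; ∧-identityʳ; not-injective; T-≡) renaming (_≟_ to _≟ᵇ_)
open import Data.Empty using (⊥; ⊥-elim)
open import Data.Fin using (Fin; zero; suc; inject₁; toℕ)
open import Data.Fin.Properties using (toℕ-inject₁)
open import Data.Fin.Subset using (Subset; _⊆_; ∣_∣; ∁; _─_) renaming (⊥ to ∅)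
open import Data.Fin.Subset.Properties
  using (_⊆?_; _⊂?_; ⊆-refl; ⊆-trans; ⊆-antisym; p⊆q⇒∣p∣≤∣q∣; drop-there; ∣⊥∣≡0; ∣p∣≤n; ∣∁p∣≡n∸∣p∣)
open import Data.List using (List; []; _∷_; _++_; length; filter; filterᵇ; map; cartesianProduct)
open import Data.List.Membership.Propositional using (_∈_)
open import Data.List.Membership.Propositional.Properties using (∈-map⁻; ∈-++⁻; ∈-filter⁺; ∈-filter⁻)
open import Data.List.Properties using (filter-++; filter-all; filter-none; filter-notAll; length-++; length-map)
import Data.List.Relation.Unary.All as All
open import Data.List.Relation.Unary.AllPairs using ([]; _∷_)
open import Data.List.Relation.Unary.Any using (here; there)
import Data.List.Relation.Unary.Any as Any
open import Data.List.Relation.Unary.Unique.Propositional using (Unique)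
import Data.List.Relation.Unary.Unique.Propositional.Properties as Unique
open import Data.Nat using (ℕ; zero; suc; _+_; _*_; _∸_; _≤_; _<_; z≤n; s≤s; _!; _/_; ⌊_/2⌋; ⌈_/2⌉; NonZero)
open import Data.Nat.Combinatorics using (_C_; nCk+nC[k+1]≡[n+1]C[k+1]; nCk≡n!/k![n-k]!; k![n∸k]!∣n!)
open import Data.Nat.DivMod using (m/n*n≡m; m/n≡1+[m∸n]/n; m/n≤m; m≥n⇒m/n>0)
open import Data.Nat.ListAction using () renaming (sum to sumˡ)
open import Data.Nat.Properties
open import Data.Nat.Solver using (module +-*-Solver)
open +-*-Solver using (solve; _:+_; _:*_; _:=_; con)
open import Data.Product using (Σ; _×_; _,_; proj₁; proj₂; map₂)
open import Data.Sum using (_⊎_; inj₁; inj₂; [_,_]′)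
open import Data.Vec using ([]; _∷_; insertAt; removeAt; lookup)
import Data.Vec as Vec
open import Data.Vec.Properties using (≡-dec; ∷-injectiveʳ)
open import Function using (_∘_; _⟨_⟩_; id; case_of_)
open import Function.Bundles using (Equivalence)
open import Function.Definitions using (Injective)
open import Relation.Binary.Construct.Closure.ReflexiveTransitive using (ε; _◅_; fold)
open import Relation.Binary.Definitions using (DecidableEquality)
open import Relation.Binary.PropositionalEquality
open import Relation.Nullary using (¬_; does; yes; no)
open import Relation.Nullary.Decidable using (T?)

open import Algebra.Properties.CommutativeSemigroup +-commutativeSemigroup
  using () renaming (x∙yz≈y∙xz to x+[y+z]≡y+[x+z])
open import Algebra.Properties.CommutativeSemigroup *-commutativeSemigroup
  using () renaming (x∙yz≈y∙xz to x*[y*z]≡y*[x*z])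
open import Algebra.Properties.Semiring.Sum +-*-semiring
  using (sum; sum-cong-≗; sum-replicate-zero; ∑-distrib-+; *-distribʳ-sum)

module _ {A : Set} where

  any-intro : ∀ (p : A → Bool) {x} xs → x ∈ xs → p x ≡ true → any p xs ≡ true
  any-intro p (y ∷ xs) (here refl) px rewrite px = refl
  any-intro p (y ∷ xs) (there x∈xs) px with p y
  ... | true  = refl
  ... | false = any-intro p xs x∈xs px

  any-elim : ∀ (p : A → Bool) xs → any p xs ≡ true → Σ A λ x → x ∈ xs × p x ≡ true
  any-elim p (y ∷ xs) e with p y in py
  ... | true  = y , here refl , py
  ... | false with any-elim p xs e
  ...   | x , x∈xs , px = x , there x∈xs , px

  any-false : ∀ (p : A → Bool) xs → any p xs ≡ false → ∀ {x} → x ∈ xs → p x ≡ false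
  any-false p (y ∷ xs) e (here refl) with p y | e
  ... | false | _ = refl
  any-false p (y ∷ xs) e (there x∈xs) with p y | e
  ... | false | e′ = any-false p xs e′ x∈xs

  ∈-filterᵇ⁺ : ∀ (p : A → Bool) {x} xs → x ∈ xs → p x ≡ true → x ∈ filterᵇ p xs
  ∈-filterᵇ⁺ p xs x∈xs px = ∈-filter⁺ (T? ∘ p) x∈xs (Equivalence.from T-≡ px)

  ∈-filterᵇ⁻ : ∀ (p : A → Bool) {x} xs → x ∈ filterᵇ p xs → x ∈ xs × p x ≡ true
  ∈-filterᵇ⁻ p xs x∈ = map₂ (Equivalence.to T-≡) (∈-filter⁻ (T? ∘ p) x∈)

  count : (A → Bool) → List A → ℕ
  count p xs = length (filterᵇ p xs)

  count-split : ∀ (q p : A → Bool) xs → count q xs ≡ count q (filterᵇ p xs) + count q (filterᵇ (not ∘ p) xs)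
  count-split q p [] = refl
  count-split q p (y ∷ xs) with p y
  ... | true with q y
  ...   | true  = cong suc (count-split q p xs)
  ...   | false = count-split q p xs
  count-split q p (y ∷ xs) | false with q y
  ...   | true  = trans (cong suc (count-split q p xs)) (sym (+-suc _ _))
  ...   | false = count-split q p xs

  count-none : ∀ (q : A → Bool) xs → (∀ {x} → x ∈ xs → q x ≡ false) → count q xs ≡ 0
  count-none q xs q≡f = cong length (filter-none (T? ∘ q) (All.tabulate λ x∈ → subst T (q≡f x∈)))

  count-all : ∀ (q : A → Bool) xs → (∀ {x} → x ∈ xs → q x ≡ true) → count q xs ≡ length xs
  count-all q xs q≡t = cong length (filter-all (T? ∘ q) (All.tabulate λ x∈ → Equivalence.from T-≡ (q≡t x∈)))

  count≤1 : ∀ (q : A → Bool) (y : A) xs → Unique xs → (∀ {x} → x ∈ xs → q x ≡ true → x ≡ y) → count q xs ≤ 1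
  count≤1 q y []       _             _    = z≤n
  count≤1 q y (x ∷ xs) (x∉xs ∷ uxs)  only with q x in qx
  ... | false = count≤1 q y xs uxs (only ∘ there)
  ... | true  = s≤s (≤-reflexive (count-none q xs λ {z} z∈xs → others z z∈xs))
    where
    others : ∀ z → z ∈ xs → q z ≡ false
    others z z∈xs with q z in qz
    ... | false = refl
    ... | true  = ⊥-elim (All.lookup x∉xs z∈xs (trans (only (here refl) qx) (sym (only (there z∈xs) qz))))

  count≤2 : ∀ (q : A → Bool) (y z : A) xs → Unique xs → (∀ {x} → x ∈ xs → q x ≡ true → x ≡ y ⊎ x ≡ z) →
            count q xs ≤ 2
  count≤2 q y z []       _            _    = z≤n
  count≤2 q y z (x ∷ xs) (x∉xs ∷ uxs) only with q x in qx
  ... | false = count≤2 q y z xs uxs (only ∘ there)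
  ... | true with only (here refl) qx
  ...   | inj₁ refl = s≤s (count≤1 q z xs uxs λ w∈xs qw →
                        [ (λ { refl → ⊥-elim (All.lookup x∉xs w∈xs refl) }) , id ]′ (only (there w∈xs) qw))
  ...   | inj₂ refl = s≤s (count≤1 q y xs uxs λ w∈xs qw →
                        [ id , (λ { refl → ⊥-elim (All.lookup x∉xs w∈xs refl) }) ]′ (only (there w∈xs) qw))

  sum-map-cong : ∀ (f g : A → ℕ) xs → (∀ {x} → x ∈ xs → f x ≡ g x) → sumˡ (map f xs) ≡ sumˡ (map g xs)
  sum-map-cong f g []       _   = refl
  sum-map-cong f g (y ∷ xs) f≗g = cong₂ _+_ (f≗g (here refl)) (sum-map-cong f g xs (f≗g ∘ there))

  sum-map-mono : ∀ (f g : A → ℕ) xs → (∀ {x} → x ∈ xs → f x ≤ g x) → sumˡ (map f xs) ≤ sumˡ (map g xs)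
  sum-map-mono f g []       _   = z≤n
  sum-map-mono f g (y ∷ xs) f≤g = +-mono-≤ (f≤g (here refl)) (sum-map-mono f g xs (f≤g ∘ there))

  sum-map-none : ∀ (f : A → ℕ) xs → (∀ {x} → x ∈ xs → f x ≡ 0) → sumˡ (map f xs) ≡ 0
  sum-map-none f []       _   = refl
  sum-map-none f (y ∷ xs) f≡0 rewrite f≡0 (here refl) = sum-map-none f xs (f≡0 ∘ there)

  sum-map-filterᵇ : ∀ (f : A → ℕ) (p : A → Bool) xs →
                    sumˡ (map f xs) ≡ sumˡ (map f (filterᵇ p xs)) + sumˡ (map f (filterᵇ (not ∘ p) xs))
  sum-map-filterᵇ f p []       = refl
  sum-map-filterᵇ f p (y ∷ xs) with p y
  ... | true  = trans (cong (f y +_) (sum-map-filterᵇ f p xs)) (sym (+-assoc (f y) _ _))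
  ... | false = trans (cong (f y +_) (sum-map-filterᵇ f p xs)) (x+[y+z]≡y+[x+z] (f y) (sumˡ (map f (filterᵇ p xs))) _)

  sum-map-≤-at : DecidableEquality A → ∀ (f : A → ℕ) y xs → Unique xs → (∀ {x} → x ∈ xs → x ≢ y → f x ≡ 0) →
                 sumˡ (map f xs) ≤ f y
  sum-map-≤-at _≟_ f y []       _            _   = z≤n
  sum-map-≤-at _≟_ f y (x ∷ xs) (x∉xs ∷ uxs) f≡0 with x ≟ y
  ... | yes refl = ≤-reflexive (trans (cong (f x +_) (sum-map-none f xs λ z∈xs →
                                       f≡0 (there z∈xs) (All.lookup x∉xs z∈xs ∘ sym)))
                                     (+-identityʳ (f x)))
  ... | no  x≢y rewrite f≡0 (here refl) x≢y = sum-map-≤-at _≟_ f y xs uxs (f≡0 ∘ there)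

  sum-map-≤-at₂ : DecidableEquality A → ∀ (f : A → ℕ) y z xs → Unique xs →
                  (∀ {x} → x ∈ xs → x ≢ y → x ≢ z → f x ≡ 0) → sumˡ (map f xs) ≤ f y + f z
  sum-map-≤-at₂ _≟_ f y z []       _            _   = z≤n
  sum-map-≤-at₂ _≟_ f y z (x ∷ xs) (x∉xs ∷ uxs) f≡0 with x ≟ y | x ≟ z
  ... | yes refl | _        = +-monoʳ-≤ (f x) (sum-map-≤-at _≟_ f z xs uxs λ w∈xs w≢z →
                                f≡0 (there w∈xs) (All.lookup x∉xs w∈xs ∘ sym) w≢z)
  ... | no  _    | yes refl = subst (_≤ f y + f x) (+-comm (sumˡ (map f xs)) (f x))
                                (+-monoˡ-≤ (f x) (sum-map-≤-at _≟_ f y xs uxs λ w∈xs w≢y →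
                                  f≡0 (there w∈xs) w≢y (All.lookup x∉xs w∈xs ∘ sym)))
  ... | no  x≢y  | no  x≢z rewrite f≡0 (here refl) x≢y x≢z = sum-map-≤-at₂ _≟_ f y z xs uxs (f≡0 ∘ there)

  count≡sum-map : ∀ (q : A → Bool) xs → count q xs ≡ sumˡ (map (λ a → if q a then 1 else 0) xs)
  count≡sum-map q []       = refl
  count≡sum-map q (x ∷ xs) with q x
  ... | true  = cong suc (count≡sum-map q xs)
  ... | false = count≡sum-map q xs

sum-mono-≤ : ∀ {n} (f g : Fin n → ℕ) → (∀ i → f i ≤ g i) → sum f ≤ sum g
sum-mono-≤ {zero}  f g f≤g = z≤n
sum-mono-≤ {suc n} f g f≤g = +-mono-≤ (f≤g zero) (sum-mono-≤ (f ∘ suc) (g ∘ suc) (f≤g ∘ suc))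

sum-≤-* : ∀ {n} (f : Fin n → ℕ) c → (∀ i → f i ≤ c) → sum f ≤ n * c
sum-≤-* {zero}  f c f≤c = z≤n
sum-≤-* {suc n} f c f≤c = +-mono-≤ (f≤c zero) (sum-≤-* (f ∘ suc) c (f≤c ∘ suc))

infix 7 _⊆ᵇ_ _⊂ᵇ_

_⊆ᵇ_ : ∀ {n} → Subset n → Subset n → Bool
[]          ⊆ᵇ []          = true
(true ∷ p)  ⊆ᵇ (false ∷ q) = false
(true ∷ p)  ⊆ᵇ (true ∷ q)  = p ⊆ᵇ q
(false ∷ p) ⊆ᵇ (_ ∷ q)     = p ⊆ᵇ q

_⊂ᵇ_ : ∀ {n} → Subset n → Subset n → Bool
p ⊂ᵇ q = p ⊆ᵇ q ∧ not (q ⊆ᵇ p)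

⊆ᵇ⇒⊆ : ∀ {n} (p q : Subset n) → p ⊆ᵇ q ≡ true → p ⊆ q
⊆ᵇ⇒⊆ (true ∷ p)  (true ∷ q)  e Vec.here      = Vec.here
⊆ᵇ⇒⊆ (true ∷ p)  (true ∷ q)  e (Vec.there x) = Vec.there (⊆ᵇ⇒⊆ p q e x)
⊆ᵇ⇒⊆ (false ∷ p) (_ ∷ q)     e (Vec.there x) = Vec.there (⊆ᵇ⇒⊆ p q e x)

⊆⇒⊆ᵇ : ∀ {n} (p q : Subset n) → p ⊆ q → p ⊆ᵇ q ≡ true
⊆⇒⊆ᵇ []          []          p⊆q = refl
⊆⇒⊆ᵇ (true ∷ p)  (true ∷ q)  p⊆q = ⊆⇒⊆ᵇ p q (λ x∈p → drop-there (p⊆q (Vec.there x∈p)))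
⊆⇒⊆ᵇ (true ∷ p)  (false ∷ q) p⊆q with () ← p⊆q Vec.here
⊆⇒⊆ᵇ (false ∷ p) (_ ∷ q)     p⊆q = ⊆⇒⊆ᵇ p q (λ x∈p → drop-there (p⊆q (Vec.there x∈p)))

⊆ᵇ-refl : ∀ {n} (p : Subset n) → p ⊆ᵇ p ≡ true
⊆ᵇ-refl p = ⊆⇒⊆ᵇ p p ⊆-refl

⊆ᵇ-trans : ∀ {n} (p q r : Subset n) → p ⊆ᵇ q ≡ true → q ⊆ᵇ r ≡ true → p ⊆ᵇ r ≡ true
⊆ᵇ-trans p q r p⊆q q⊆r = ⊆⇒⊆ᵇ p r (⊆-trans (⊆ᵇ⇒⊆ p q p⊆q) (⊆ᵇ⇒⊆ q r q⊆r))

⊆ᵇ-antisym : ∀ {n} (p q : Subset n) → p ⊆ᵇ q ≡ true → q ⊆ᵇ p ≡ true → p ≡ q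
⊆ᵇ-antisym p q p⊆q q⊆p = ⊆-antisym (⊆ᵇ⇒⊆ p q p⊆q) (⊆ᵇ⇒⊆ q p q⊆p)

∣∣-mono-⊆ᵇ : ∀ {n} (p q : Subset n) → p ⊆ᵇ q ≡ true → ∣ p ∣ ≤ ∣ q ∣
∣∣-mono-⊆ᵇ p q p⊆q = p⊆q⇒∣p∣≤∣q∣ (⊆ᵇ⇒⊆ p q p⊆q)

∅-⊆ᵇ : ∀ {n} (p : Subset n) → ∅ ⊆ᵇ p ≡ true
∅-⊆ᵇ []      = refl
∅-⊆ᵇ (_ ∷ p) = ∅-⊆ᵇ p

⊆ᵇ-∅ : ∀ {n} (p : Subset n) → p ⊆ᵇ ∅ ≡ true → p ≡ ∅
⊆ᵇ-∅ []          _ = refl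
⊆ᵇ-∅ (false ∷ p) e = cong (false ∷_) (⊆ᵇ-∅ p e)

∣p∣≡0⇒p≡∅ : ∀ {n} (p : Subset n) → ∣ p ∣ ≡ 0 → p ≡ ∅
∣p∣≡0⇒p≡∅ []          _ = refl
∣p∣≡0⇒p≡∅ (false ∷ p) e = cong (false ∷_) (∣p∣≡0⇒p≡∅ p e)

⊆ᵇ-∣∣-≡ : ∀ {n} (p q : Subset n) → p ⊆ᵇ q ≡ true → ∣ p ∣ ≡ ∣ q ∣ → p ≡ q
⊆ᵇ-∣∣-≡ []          []          _ _ = refl
⊆ᵇ-∣∣-≡ (true ∷ p)  (true ∷ q)  s e = cong (true ∷_) (⊆ᵇ-∣∣-≡ p q s (suc-injective e))
⊆ᵇ-∣∣-≡ (false ∷ p) (true ∷ q)  s e = ⊥-elim (<-irrefl e (s≤s (∣∣-mono-⊆ᵇ p q s)))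
⊆ᵇ-∣∣-≡ (false ∷ p) (false ∷ q) s e = cong (false ∷_) (⊆ᵇ-∣∣-≡ p q s e)

⊂ᵇ⇒⊆ᵇ : ∀ {n} (p q : Subset n) → p ⊂ᵇ q ≡ true → p ⊆ᵇ q ≡ true
⊂ᵇ⇒⊆ᵇ p q e with p ⊆ᵇ q
... | true = refl

⊂ᵇ⇒⊉ᵇ : ∀ {n} (p q : Subset n) → p ⊂ᵇ q ≡ true → q ⊆ᵇ p ≡ false
⊂ᵇ⇒⊉ᵇ p q e with p ⊆ᵇ q | q ⊆ᵇ p
... | true | false = refl

⊂ᵇ-irrefl : ∀ {n} (p : Subset n) → p ⊂ᵇ p ≡ false
⊂ᵇ-irrefl p rewrite ⊆ᵇ-refl p = refl

⊂ᵇ⇒≢ : ∀ {n} (p q : Subset n) → p ⊂ᵇ q ≡ true → p ≢ q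
⊂ᵇ⇒≢ p q e refl with () ← trans (sym e) (⊂ᵇ-irrefl p)

⊆ᵇ∧≢⇒⊂ᵇ : ∀ {n} (p q : Subset n) → p ⊆ᵇ q ≡ true → p ≢ q → p ⊂ᵇ q ≡ true
⊆ᵇ∧≢⇒⊂ᵇ p q p⊆q p≢q with q ⊆ᵇ p in q⊆p
... | true  = ⊥-elim (p≢q (⊆ᵇ-antisym p q p⊆q q⊆p))
... | false rewrite p⊆q = refl

⊂ᵇ-trans : ∀ {n} (p q r : Subset n) → p ⊂ᵇ q ≡ true → q ⊂ᵇ r ≡ true → p ⊂ᵇ r ≡ true
⊂ᵇ-trans p q r p⊂q q⊂r = ⊆ᵇ∧≢⇒⊂ᵇ p r (⊆ᵇ-trans p q r (⊂ᵇ⇒⊆ᵇ p q p⊂q) (⊂ᵇ⇒⊆ᵇ q r q⊂r))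
  λ { refl → ⊂ᵇ⇒≢ p q p⊂q (⊆ᵇ-antisym p q (⊂ᵇ⇒⊆ᵇ p q p⊂q) (⊂ᵇ⇒⊆ᵇ q p q⊂r)) }

⊂ᵇ-asym : ∀ {n} (p q : Subset n) → p ⊂ᵇ q ≡ true → q ⊂ᵇ p ≡ false
⊂ᵇ-asym p q p⊂q with q ⊂ᵇ p in q⊂p
... | false = refl
... | true with () ← trans (sym (⊂ᵇ⇒⊉ᵇ p q p⊂q)) (⊂ᵇ⇒⊆ᵇ q p q⊂p)

⊂ᵇ⇒∣∣< : ∀ {n} (p q : Subset n) → p ⊂ᵇ q ≡ true → ∣ p ∣ < ∣ q ∣
⊂ᵇ⇒∣∣< p q p⊂q with m≤n⇒m<n∨m≡n (∣∣-mono-⊆ᵇ p q (⊂ᵇ⇒⊆ᵇ p q p⊂q))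
... | inj₁ lt = lt
... | inj₂ eq = ⊥-elim (⊂ᵇ⇒≢ p q p⊂q (⊆ᵇ-∣∣-≡ p q (⊂ᵇ⇒⊆ᵇ p q p⊂q) eq))

_≟ˢ_ : ∀ {n} → DecidableEquality (Subset n)
_≟ˢ_ = ≡-dec _≟ᵇ_

∣p∣+∣∁p∣≡n : ∀ {n} (p : Subset n) → ∣ p ∣ + ∣ ∁ p ∣ ≡ n
∣p∣+∣∁p∣≡n p = trans (cong (∣ p ∣ +_) (∣∁p∣≡n∸∣p∣ p)) (m+[n∸m]≡n (∣p∣≤n p))

does-⊆? : ∀ {n} (p q : Subset n) → does (p ⊆? q) ≡ p ⊆ᵇ q
does-⊆? []          []          = refl
does-⊆? (false ∷ p) (_ ∷ q)     = does-⊆? p q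
does-⊆? (true ∷ p)  (false ∷ q) = refl
does-⊆? (true ∷ p)  (true ∷ q)  = does-⊆? p q

does-⊂? : ∀ {n} (p q : Subset n) → does (p ⊂? q) ≡ p ⊂ᵇ q
does-⊂? []          []          = refl
does-⊂? (false ∷ p) (false ∷ q) = does-⊂? p q
does-⊂? (false ∷ p) (true ∷ q)  = trans (does-⊆? p q) (sym (∧-identityʳ (p ⊆ᵇ q)))
does-⊂? (true ∷ p)  (false ∷ q) = refl
does-⊂? (true ∷ p)  (true ∷ q)  = does-⊂? p q

⊆ᵇ-insertAt : ∀ {n} (p q : Subset n) i x → insertAt p i x ⊆ᵇ insertAt q i x ≡ p ⊆ᵇ q
⊆ᵇ-insertAt p           q           zero    true  = refl
⊆ᵇ-insertAt p           q           zero    false = refl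
⊆ᵇ-insertAt (true ∷ p)  (true ∷ q)  (suc i) x     = ⊆ᵇ-insertAt p q i x
⊆ᵇ-insertAt (true ∷ p)  (false ∷ q) (suc i) x     = refl
⊆ᵇ-insertAt (false ∷ p) (_ ∷ q)     (suc i) x     = ⊆ᵇ-insertAt p q i x

⊆ᵇ-insertAt-true : ∀ {n} (p : Subset (suc n)) (s : Subset n) i →
                   p ⊆ᵇ insertAt s i true ≡ removeAt p i ⊆ᵇ s
⊆ᵇ-insertAt-true (true ∷ p)            s           zero    = refl
⊆ᵇ-insertAt-true (false ∷ p)           s           zero    = refl
⊆ᵇ-insertAt-true (true ∷ p@(_ ∷ _))    (true ∷ s)  (suc i) = ⊆ᵇ-insertAt-true p s i
⊆ᵇ-insertAt-true (true ∷ p@(_ ∷ _))    (false ∷ s) (suc i) = refl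
⊆ᵇ-insertAt-true (false ∷ p@(_ ∷ _))   (_ ∷ s)     (suc i) = ⊆ᵇ-insertAt-true p s i

insertAt-true-⊆ᵇ : ∀ {n} (s : Subset n) (p : Subset (suc n)) i →
                   insertAt s i true ⊆ᵇ p ≡ lookup p i ∧ s ⊆ᵇ removeAt p i
insertAt-true-⊆ᵇ s           (true ∷ p)           zero    = refl
insertAt-true-⊆ᵇ s           (false ∷ p)          zero    = refl
insertAt-true-⊆ᵇ (true ∷ s)  (true ∷ p@(_ ∷ _))   (suc i) = insertAt-true-⊆ᵇ s p i
insertAt-true-⊆ᵇ (true ∷ s)  (false ∷ p@(_ ∷ _))  (suc i) with lookup p i
... | true  = refl
... | false = refl
insertAt-true-⊆ᵇ (false ∷ s) (_ ∷ p@(_ ∷ _))      (suc i) = insertAt-true-⊆ᵇ s p i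

⊆ᵇ-lookup : ∀ {n} (p q : Subset n) i → p ⊆ᵇ q ≡ true → lookup p i ≡ true → lookup q i ≡ true
⊆ᵇ-lookup (true ∷ p)  (true ∷ q)  zero    _ _ = refl
⊆ᵇ-lookup (true ∷ p)  (true ∷ q)  (suc i) s e = ⊆ᵇ-lookup p q i s e
⊆ᵇ-lookup (false ∷ p) (_ ∷ q)     (suc i) s e = ⊆ᵇ-lookup p q i s e

⊆ᵇ-removeAt : ∀ {n} (p q : Subset (suc n)) i → p ⊆ᵇ q ≡ true → removeAt p i ⊆ᵇ removeAt q i ≡ true
⊆ᵇ-removeAt (true ∷ p)           (true ∷ q)          zero    s = s
⊆ᵇ-removeAt (false ∷ p)          (_ ∷ q)             zero    s = s
⊆ᵇ-removeAt (true ∷ p@(_ ∷ _))   (true ∷ q@(_ ∷ _))  (suc i) s = ⊆ᵇ-removeAt p q i s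
⊆ᵇ-removeAt (false ∷ p@(_ ∷ _))  (_ ∷ q@(_ ∷ _))     (suc i) s = ⊆ᵇ-removeAt p q i s

∣removeAt∣-inside : ∀ {n} (p : Subset (suc n)) i → lookup p i ≡ true → suc ∣ removeAt p i ∣ ≡ ∣ p ∣
∣removeAt∣-inside (true ∷ p)          zero    _ = refl
∣removeAt∣-inside (true ∷ p@(_ ∷ _))  (suc i) e = cong suc (∣removeAt∣-inside p i e)
∣removeAt∣-inside (false ∷ p@(_ ∷ _)) (suc i) e = ∣removeAt∣-inside p i e

∣removeAt∣-outside : ∀ {n} (p : Subset (suc n)) i → lookup p i ≡ false → ∣ removeAt p i ∣ ≡ ∣ p ∣
∣removeAt∣-outside (false ∷ p)          zero    _ = refl
∣removeAt∣-outside (true ∷ p@(_ ∷ _))   (suc i) e = cong suc (∣removeAt∣-outside p i e)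
∣removeAt∣-outside (false ∷ p@(_ ∷ _))  (suc i) e = ∣removeAt∣-outside p i e

∣∁removeAt∣-inside : ∀ {n} (p : Subset (suc n)) i → lookup p i ≡ true → ∣ ∁ (removeAt p i) ∣ ≡ ∣ ∁ p ∣
∣∁removeAt∣-inside (true ∷ p)          zero    _ = refl
∣∁removeAt∣-inside (true ∷ p@(_ ∷ _))  (suc i) e = ∣∁removeAt∣-inside p i e
∣∁removeAt∣-inside (false ∷ p@(_ ∷ _)) (suc i) e = cong suc (∣∁removeAt∣-inside p i e)

-- Counting maximal chains

_↑_ : ∀ {n} → (Subset (suc n) → Bool) → Fin (suc n) → Subset n → Bool
(𝒢 ↑ i) s = 𝒢 (insertAt s i true)

-- #chains n 𝒢 is the number of maximal chains ∅ = C₀ ⊂ C₁ ⊂ ⋯ ⊂ Cₙ = [n] meeting 𝒢.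
-- A chain that misses 𝒢 at ∅ continues with some {i}, and the rest of it is a maximal
-- chain of the sets containing i, which insertAt · i true identifies with the cube on n points.
#chains : ∀ n → (Subset n → Bool) → ℕ
#chains zero    𝒢 = if 𝒢 [] then 1 else 0
#chains (suc n) 𝒢 = if 𝒢 ∅ then suc n ! else sum λ i → #chains n (𝒢 ↑ i)

#chains-∅∈ : ∀ n (𝒢 : Subset (suc n) → Bool) → 𝒢 ∅ ≡ true → #chains (suc n) 𝒢 ≡ suc n !
#chains-∅∈ n 𝒢 e rewrite e = refl

#chains-∅∉ : ∀ n (𝒢 : Subset (suc n) → Bool) → 𝒢 ∅ ≡ false →
             #chains (suc n) 𝒢 ≡ sum λ i → #chains n (𝒢 ↑ i)
#chains-∅∉ n 𝒢 e rewrite e = refl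

#chains-cong : ∀ n (𝒢 ℋ : Subset n → Bool) → (∀ s → 𝒢 s ≡ ℋ s) → #chains n 𝒢 ≡ #chains n ℋ
#chains-cong zero    𝒢 ℋ 𝒢≗ℋ rewrite 𝒢≗ℋ [] = refl
#chains-cong (suc n) 𝒢 ℋ 𝒢≗ℋ rewrite 𝒢≗ℋ ∅ with ℋ ∅
... | true  = refl
... | false = sum-cong-≗ λ i → #chains-cong n (𝒢 ↑ i) (ℋ ↑ i) (𝒢≗ℋ ∘ λ s → insertAt s i true)

#chains≤n! : ∀ n (𝒢 : Subset n → Bool) → #chains n 𝒢 ≤ n !
#chains≤n! zero 𝒢 with 𝒢 []
... | true  = ≤-refl
... | false = z≤n
#chains≤n! (suc n) 𝒢 with 𝒢 ∅
... | true  = ≤-refl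
... | false = sum-≤-* (λ i → #chains n (𝒢 ↑ i)) (n !) (λ i → #chains≤n! n (𝒢 ↑ i))

#chains-empty : ∀ n (𝒢 : Subset n → Bool) → (∀ s → 𝒢 s ≡ false) → #chains n 𝒢 ≡ 0
#chains-empty zero    𝒢 𝒢≗∅ rewrite 𝒢≗∅ [] = refl
#chains-empty (suc n) 𝒢 𝒢≗∅ rewrite 𝒢≗∅ ∅ = trans
  (sum-cong-≗ λ i → #chains-empty n (𝒢 ↑ i) (𝒢≗∅ ∘ λ s → insertAt s i true))
  (sum-replicate-zero (suc n))

#chains-mono : ∀ n (𝒢 ℋ : Subset n → Bool) → (∀ s → 𝒢 s ≡ true → ℋ s ≡ true) →
               #chains n 𝒢 ≤ #chains n ℋ
#chains-mono zero 𝒢 ℋ 𝒢⊆ℋ with 𝒢 [] in e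
... | true rewrite 𝒢⊆ℋ [] e = ≤-refl
... | false = z≤n
#chains-mono (suc n) 𝒢 ℋ 𝒢⊆ℋ with ℋ ∅ in eℋ
... | true = #chains≤n! (suc n) 𝒢
... | false with 𝒢 ∅ in e𝒢
...   | true with () ← trans (sym eℋ) (𝒢⊆ℋ ∅ e𝒢)
...   | false = sum-mono-≤ _ _ λ i → #chains-mono n (𝒢 ↑ i) (ℋ ↑ i) (𝒢⊆ℋ ∘ λ s → insertAt s i true)

Incomparable : ∀ {n} → (Subset n → Bool) → (Subset n → Bool) → Set
Incomparable 𝒢 ℋ = ∀ s t → 𝒢 s ≡ true → ℋ t ≡ true → (s ⊆ᵇ t ≡ false) × (t ⊆ᵇ s ≡ false)

Incomparable-↑ : ∀ {n} (𝒢 ℋ : Subset (suc n) → Bool) i → Incomparable 𝒢 ℋ → Incomparable (𝒢 ↑ i) (ℋ ↑ i)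
Incomparable-↑ 𝒢 ℋ i inc s t s∈𝒢 t∈ℋ with inc _ _ s∈𝒢 t∈ℋ
... | s⊈t , t⊈s = trans (sym (⊆ᵇ-insertAt s t i true)) s⊈t , trans (sym (⊆ᵇ-insertAt t s i true)) t⊈s

Incomparable-∅ : ∀ {n} (𝒢 ℋ : Subset n → Bool) → Incomparable 𝒢 ℋ → 𝒢 ∅ ≡ true → ∀ s → ℋ s ≡ false
Incomparable-∅ 𝒢 ℋ inc ∅∈𝒢 s with ℋ s in s∈ℋ
... | false = refl
... | true with () ← trans (sym (∅-⊆ᵇ s)) (proj₁ (inc _ _ ∅∈𝒢 s∈ℋ))

Incomparable-sym : ∀ {n} (𝒢 ℋ : Subset n → Bool) → Incomparable 𝒢 ℋ → Incomparable ℋ 𝒢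
Incomparable-sym 𝒢 ℋ inc s t s∈ℋ t∈𝒢 with inc t s t∈𝒢 s∈ℋ
... | t⊈s , s⊈t = s⊈t , t⊈s

#chains-∨-empty : ∀ n (𝒢 ℋ : Subset n → Bool) → (∀ s → ℋ s ≡ false) →
                  #chains n (λ s → 𝒢 s ∨ ℋ s) ≡ #chains n 𝒢 + #chains n ℋ
#chains-∨-empty n 𝒢 ℋ ℋ≗∅ = begin
  #chains n (λ s → 𝒢 s ∨ ℋ s)  ≡⟨ #chains-cong n _ 𝒢 (λ s → trans (cong (𝒢 s ∨_) (ℋ≗∅ s)) (∨-identityʳ (𝒢 s))) ⟩
  #chains n 𝒢                  ≡⟨ +-identityʳ _ ⟨
  #chains n 𝒢 + 0              ≡⟨ cong (#chains n 𝒢 +_) (#chains-empty n ℋ ℋ≗∅) ⟨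
  #chains n 𝒢 + #chains n ℋ    ∎
  where open ≡-Reasoning

-- A maximal chain meets at most one of two incomparable families, so their counts add up.
#chains-∨ : ∀ n (𝒢 ℋ : Subset n → Bool) → Incomparable 𝒢 ℋ →
            #chains n (λ s → 𝒢 s ∨ ℋ s) ≡ #chains n 𝒢 + #chains n ℋ
#chains-∨ zero 𝒢 ℋ inc with 𝒢 [] in e𝒢 | ℋ [] in eℋ
... | true  | true with () ← proj₁ (inc [] [] e𝒢 eℋ)
... | true  | false = refl
... | false | true  = refl
... | false | false = refl
#chains-∨ (suc n) 𝒢 ℋ inc = by-cases (𝒢 ∅) (ℋ ∅) refl refl
  where
  open ≡-Reasoning
  by-cases : ∀ b c → 𝒢 ∅ ≡ b → ℋ ∅ ≡ c → #chains (suc n) (λ s → 𝒢 s ∨ ℋ s) ≡ #chains (suc n) 𝒢 + #chains (suc n) ℋ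
  by-cases true  _     e𝒢 _  = #chains-∨-empty (suc n) 𝒢 ℋ (Incomparable-∅ 𝒢 ℋ inc e𝒢)
  by-cases false true  _  eℋ = begin
    #chains (suc n) (λ s → 𝒢 s ∨ ℋ s)  ≡⟨ #chains-cong (suc n) _ _ (λ s → ∨-comm (𝒢 s) (ℋ s)) ⟩
    #chains (suc n) (λ s → ℋ s ∨ 𝒢 s)
      ≡⟨ #chains-∨-empty (suc n) ℋ 𝒢 (Incomparable-∅ ℋ 𝒢 (Incomparable-sym 𝒢 ℋ inc) eℋ) ⟩
    #chains (suc n) ℋ + #chains (suc n) 𝒢  ≡⟨ +-comm (#chains (suc n) ℋ) _ ⟩
    #chains (suc n) 𝒢 + #chains (suc n) ℋ  ∎
  by-cases false false e𝒢 eℋ = begin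
    #chains (suc n) (λ s → 𝒢 s ∨ ℋ s)
      ≡⟨ #chains-∅∉ n (λ s → 𝒢 s ∨ ℋ s) (cong₂ _∨_ e𝒢 eℋ) ⟩
    (sum λ i → #chains n (λ s → (𝒢 ↑ i) s ∨ (ℋ ↑ i) s))
      ≡⟨ sum-cong-≗ (λ i → #chains-∨ n (𝒢 ↑ i) (ℋ ↑ i) (Incomparable-↑ 𝒢 ℋ i inc)) ⟩
    (sum λ i → #chains n (𝒢 ↑ i) + #chains n (ℋ ↑ i))
      ≡⟨ ∑-distrib-+ (λ i → #chains n (𝒢 ↑ i)) (λ i → #chains n (ℋ ↑ i)) ⟩
    (sum λ i → #chains n (𝒢 ↑ i)) + (sum λ i → #chains n (ℋ ↑ i))
      ≡⟨ cong₂ _+_ (#chains-∅∉ n 𝒢 e𝒢) (#chains-∅∉ n ℋ eℋ) ⟨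
    #chains (suc n) 𝒢 + #chains (suc n) ℋ
      ∎

interval : ∀ {n} → Subset n → Subset n → Subset n → Bool
interval a c s = a ⊆ᵇ s ∧ s ⊆ᵇ c

interval-↑ : ∀ {n} (a c : Subset (suc n)) i s →
             (interval a c ↑ i) s ≡ lookup c i ∧ interval (removeAt a i) (removeAt c i) s
interval-↑ a c i s rewrite ⊆ᵇ-insertAt-true a s i | insertAt-true-⊆ᵇ s c i
  with lookup c i | removeAt a i ⊆ᵇ s
... | true  | true  = refl
... | true  | false = refl
... | false | true  = refl
... | false | false = refl

∣p∣+∣q─p∣+∣∁q∣≡n : ∀ {n} (p q : Subset n) → p ⊆ᵇ q ≡ true → ∣ p ∣ + ∣ q ─ p ∣ + ∣ ∁ q ∣ ≡ n
∣p∣+∣q─p∣+∣∁q∣≡n []          []          _ = refl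
∣p∣+∣q─p∣+∣∁q∣≡n (true ∷ p)  (true ∷ q)  s = cong suc (∣p∣+∣q─p∣+∣∁q∣≡n p q s)
∣p∣+∣q─p∣+∣∁q∣≡n (false ∷ p) (true ∷ q)  s =
  trans (cong (_+ ∣ ∁ q ∣) (+-suc ∣ p ∣ ∣ q ─ p ∣)) (cong suc (∣p∣+∣q─p∣+∣∁q∣≡n p q s))
∣p∣+∣q─p∣+∣∁q∣≡n (false ∷ p) (false ∷ q) s =
  trans (+-suc (∣ p ∣ + ∣ q ─ p ∣) ∣ ∁ q ∣) (cong suc (∣p∣+∣q─p∣+∣∁q∣≡n p q s))

sum-over-interval : ∀ {n} (p q : Subset n) → p ⊆ᵇ q ≡ true → (f : Fin n → ℕ) (α β : ℕ) →
  (∀ i → lookup q i ≡ false → f i ≡ 0) →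
  (∀ i → lookup p i ≡ true → f i ≡ α) →
  (∀ i → lookup p i ≡ false → lookup q i ≡ true → f i ≡ β) →
  sum f ≡ ∣ p ∣ * α + ∣ q ─ p ∣ * β
sum-over-interval []          []          _ f α β f₀ fα fβ = refl
sum-over-interval (true ∷ p)  (true ∷ q)  s f α β f₀ fα fβ = begin
  f zero + sum (f ∘ suc)
    ≡⟨ cong₂ _+_ (fα zero refl) (sum-over-interval p q s (f ∘ suc) α β (f₀ ∘ suc) (fα ∘ suc) (fβ ∘ suc)) ⟩
  α + (∣ p ∣ * α + ∣ q ─ p ∣ * β)
    ≡⟨ +-assoc α (∣ p ∣ * α) _ ⟨
  α + ∣ p ∣ * α + ∣ q ─ p ∣ * β
    ∎
  where open ≡-Reasoning
sum-over-interval (false ∷ p) (true ∷ q)  s f α β f₀ fα fβ = begin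
  f zero + sum (f ∘ suc)
    ≡⟨ cong₂ _+_ (fβ zero refl refl) (sum-over-interval p q s (f ∘ suc) α β (f₀ ∘ suc) (fα ∘ suc) (fβ ∘ suc)) ⟩
  β + (∣ p ∣ * α + ∣ q ─ p ∣ * β)
    ≡⟨ x+[y+z]≡y+[x+z] β (∣ p ∣ * α) _ ⟩
  ∣ p ∣ * α + (β + ∣ q ─ p ∣ * β)
    ∎
  where open ≡-Reasoning
sum-over-interval (false ∷ p) (false ∷ q) s f α β f₀ fα fβ =
  cong₂ _+_ (f₀ zero refl) (sum-over-interval p q s (f ∘ suc) α β (f₀ ∘ suc) (fα ∘ suc) (fβ ∘ suc))

-- A maximal chain meets the interval [a , c] iff it lists the points of a before those
-- outside c, which happens for a fraction 1 / binom(∣a∣ + ∣∁c∣, ∣a∣) of the chains.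
#chains-interval : ∀ n (a c : Subset n) → a ⊆ᵇ c ≡ true →
  #chains n (interval a c) * (∣ a ∣ + ∣ ∁ c ∣) ! ≡ n ! * (∣ a ∣ ! * ∣ ∁ c ∣ !)
#chains-interval zero    []       []  _   = refl
#chains-interval (suc n) a        c   a⊆c with ∣ a ∣ in ∣a∣≡
... | zero with refl ← ∣p∣≡0⇒p≡∅ a ∣a∣≡ rewrite #chains-∅∈ n (interval ∅ c) (cong₂ _∧_ (∅-⊆ᵇ {suc n} ∅) (∅-⊆ᵇ c)) =
  cong (suc n ! *_) (sym (+-identityʳ (∣ ∁ c ∣ !)))
... | suc k = begin
  #chains (suc n) (interval a c) * (suc k + t) !
    ≡⟨ cong (_* (suc k + t) !) (#chains-∅∉ n (interval a c) ∅∉[a,c]) ⟩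
  sum f * (suc k + t) !
    ≡⟨ *-distribʳ-sum ((suc k + t) !) f ⟩
  sum (λ i → f i * (suc k + t) !)
    ≡⟨ sum-over-interval a c a⊆c _ α β outside-c inside-a inside-c∖a ⟩
  ∣ a ∣ * α + ∣ c ─ a ∣ * β
    ≡⟨ cong (λ m → m * α + ∣ c ─ a ∣ * β) ∣a∣≡ ⟩
  suc k * α + ∣ c ─ a ∣ * β
    ≡⟨ contributions ⟩
  ((suc k + ∣ c ─ a ∣ + t) * n !) * (suc k ! * t !)
    ≡⟨ cong (λ m → (m * n !) * (suc k ! * t !))
            (trans (cong (λ m → m + ∣ c ─ a ∣ + t) (sym ∣a∣≡)) (∣p∣+∣q─p∣+∣∁q∣≡n a c a⊆c)) ⟩
  suc n ! * (suc k ! * t !)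
    ∎
  where
  open ≡-Reasoning
  t : ℕ
  t = ∣ ∁ c ∣
  f : Fin (suc n) → ℕ
  f i = #chains n (interval a c ↑ i)
  α β : ℕ
  α = suc (k + t) * (n ! * (k ! * t !))
  β = n ! * (suc k ! * t !)
  contributions : suc k * α + ∣ c ─ a ∣ * β ≡ ((suc k + ∣ c ─ a ∣ + t) * n !) * (suc k ! * t !)
  contributions = solve 6 (λ k t g N K T →
      (con 1 :+ k) :* ((con 1 :+ (k :+ t)) :* (N :* (K :* T))) :+ g :* (N :* (((con 1 :+ k) :* K) :* T))
    := (((con 1 :+ k) :+ g :+ t) :* N) :* (((con 1 :+ k) :* K) :* T)) refl k t ∣ c ─ a ∣ (n !) (k !) (t !)
  ∅∉[a,c] : interval a c ∅ ≡ false
  ∅∉[a,c] with a ⊆ᵇ ∅ in a⊆∅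
  ... | false = refl
  ... | true with () ← trans (sym (∣⊥∣≡0 (suc n))) (trans (cong ∣_∣ (sym (⊆ᵇ-∅ a a⊆∅))) ∣a∣≡)
  f-inside-c : ∀ i → lookup c i ≡ true → f i ≡ #chains n (interval (removeAt a i) (removeAt c i))
  f-inside-c i i∈c = #chains-cong n _ _ λ s →
    trans (interval-↑ a c i s) (cong (_∧ interval (removeAt a i) (removeAt c i) s) i∈c)
  ih : ∀ i {x y} → ∣ removeAt a i ∣ ≡ x → ∣ ∁ (removeAt c i) ∣ ≡ y →
       #chains n (interval (removeAt a i) (removeAt c i)) * (x + y) ! ≡ n ! * (x ! * y !)
  ih i refl refl = #chains-interval n (removeAt a i) (removeAt c i) (⊆ᵇ-removeAt a c i a⊆c)
  outside-c : ∀ i → lookup c i ≡ false → f i * (suc k + t) ! ≡ 0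
  outside-c i i∉c = cong (_* (suc k + t) !)
    (#chains-empty n _ λ s → trans (interval-↑ a c i s) (cong (_∧ interval (removeAt a i) (removeAt c i) s) i∉c))
  inside-a : ∀ i → lookup a i ≡ true → f i * (suc k + t) ! ≡ α
  inside-a i i∈a = begin
    f i * (suc (k + t) * (k + t) !)   ≡⟨ cong (_* _) (f-inside-c i i∈c) ⟩
    m * (suc (k + t) * (k + t) !)     ≡⟨ x*[y*z]≡y*[x*z] m (suc (k + t)) _ ⟩
    suc (k + t) * (m * (k + t) !)     ≡⟨ cong (suc (k + t) *_) (ih i ∣a′∣≡k (∣∁removeAt∣-inside c i i∈c)) ⟩
    α                                 ∎
    where
    i∈c : lookup c i ≡ true
    i∈c = ⊆ᵇ-lookup a c i a⊆c i∈a
    m : ℕ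
    m = #chains n (interval (removeAt a i) (removeAt c i))
    ∣a′∣≡k : ∣ removeAt a i ∣ ≡ k
    ∣a′∣≡k = suc-injective (trans (∣removeAt∣-inside a i i∈a) ∣a∣≡)
  inside-c∖a : ∀ i → lookup a i ≡ false → lookup c i ≡ true → f i * (suc k + t) ! ≡ β
  inside-c∖a i i∉a i∈c = trans (cong (_* _) (f-inside-c i i∈c))
    (ih i (trans (∣removeAt∣-outside a i i∉a) ∣a∣≡) (∣∁removeAt∣-inside c i i∈c))

-- The number of maximal chains through a middle-level set, the fewest through any set.
midChains : ℕ → ℕ
midChains n = ⌊ n /2⌋ ! * ⌈ n /2⌉ !

midChains-suc : ∀ n → midChains (suc n) ≡ suc ⌊ n /2⌋ * midChains n
midChains-suc n = begin
  ⌈ n /2⌉ ! * (suc ⌊ n /2⌋ * ⌊ n /2⌋ !)  ≡⟨ x*[y*z]≡y*[x*z] (⌈ n /2⌉ !) (suc ⌊ n /2⌋) _ ⟩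
  suc ⌊ n /2⌋ * (⌈ n /2⌉ ! * ⌊ n /2⌋ !)  ≡⟨ cong (suc ⌊ n /2⌋ *_) (*-comm (⌈ n /2⌉ !) _) ⟩
  suc ⌊ n /2⌋ * midChains n             ∎
  where open ≡-Reasoning

midChains≢0 : ∀ n → NonZero (midChains n)
midChains≢0 n = m*n≢0 (⌊ n /2⌋ !) (⌈ n /2⌉ !) {{⌊ n /2⌋ !≢0}} {{⌈ n /2⌉ !≢0}}

⌊n/2⌋≡n/2 : ∀ n → ⌊ n /2⌋ ≡ n / 2
⌊n/2⌋≡n/2 zero          = refl
⌊n/2⌋≡n/2 (suc zero)    = refl
⌊n/2⌋≡n/2 (suc (suc n)) = trans (cong suc (⌊n/2⌋≡n/2 n)) (sym (m/n≡1+[m∸n]/n {suc (suc n)} {2} (s≤s (s≤s z≤n))))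

binomial*midChains≡n! : ∀ n → (n C (n / 2)) * midChains n ≡ n !
binomial*midChains≡n! n = begin
  (n C k) * midChains n                    ≡⟨ cong₂ _*_ (nCk≡n!/k![n-k]! k≤n) midChains≡ ⟩
  (n ! / (k ! * (n ∸ k) !)) * (k ! * (n ∸ k) !)  ≡⟨ m/n*n≡m (k![n∸k]!∣n! k≤n) ⟩
  n !                                      ∎
  where
  open ≡-Reasoning
  k : ℕ
  k = n / 2
  k≤n : k ≤ n
  k≤n = m/n≤m n 2
  instance
    _ : NonZero (k ! * (n ∸ k) !)
    _ = m*n≢0 (k !) ((n ∸ k) !) {{k !≢0}} {{(n ∸ k) !≢0}}
  n∸⌊n/2⌋≡⌈n/2⌉ : n ∸ ⌊ n /2⌋ ≡ ⌈ n /2⌉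
  n∸⌊n/2⌋≡⌈n/2⌉ = trans (cong (_∸ ⌊ n /2⌋) (sym (⌊n/2⌋+⌈n/2⌉≡n n))) (m+n∸m≡n ⌊ n /2⌋ ⌈ n /2⌉)
  midChains≡ : midChains n ≡ k ! * (n ∸ k) !
  midChains≡ = subst (λ m → midChains n ≡ m ! * (n ∸ m) !) (⌊n/2⌋≡n/2 n)
                     (cong (λ m → ⌊ n /2⌋ ! * m !) (sym n∸⌊n/2⌋≡⌈n/2⌉))

halves-cover : ∀ m a t → a + t ≡ suc m → ⌊ m /2⌋ < a ⊎ ⌊ m /2⌋ < t
halves-cover m a t a+t≡ with ⌊ m /2⌋ <? a
... | yes h<a = inj₁ h<a
... | no  h≮a = inj₂ (≰⇒> λ t≤h → <-irrefl a+t≡ (s≤s (begin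
  a + t                  ≤⟨ +-mono-≤ (≮⇒≥ h≮a) t≤h ⟩
  ⌊ m /2⌋ + ⌊ m /2⌋       ≤⟨ +-monoʳ-≤ ⌊ m /2⌋ (⌊n/2⌋≤⌈n/2⌉ m) ⟩
  ⌊ m /2⌋ + ⌈ m /2⌉       ≡⟨ ⌊n/2⌋+⌈n/2⌉≡n m ⟩
  m                      ∎)))
  where open ≤-Reasoning

midChains≤ : ∀ n a t → a + t ≡ n → midChains n ≤ a ! * t !
midChains≤ zero    zero    zero    _    = ≤-refl
midChains≤ (suc m) a       t       a+t≡ with halves-cover m a t a+t≡
midChains≤ (suc m) (suc a) t       a+t≡ | inj₁ (s≤s h≤a) = begin
  midChains (suc m)          ≡⟨ midChains-suc m ⟩
  suc ⌊ m /2⌋ * midChains m  ≤⟨ *-mono-≤ (s≤s h≤a) (midChains≤ m a t (suc-injective a+t≡)) ⟩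
  suc a * (a ! * t !)        ≡⟨ *-assoc (suc a) (a !) (t !) ⟨
  suc a ! * t !              ∎
  where open ≤-Reasoning
midChains≤ (suc m) a       (suc t) a+t≡ | inj₂ (s≤s h≤t) = begin
  midChains (suc m)          ≡⟨ midChains-suc m ⟩
  suc ⌊ m /2⌋ * midChains m  ≤⟨ *-mono-≤ (s≤s h≤t) (midChains≤ m a t (suc-injective (trans (sym (+-suc a t)) a+t≡))) ⟩
  suc t * (a ! * t !)        ≡⟨ x*[y*z]≡y*[x*z] (suc t) (a !) (t !) ⟩
  a ! * suc t !              ∎
  where open ≤-Reasoning

-- midChains (3 + s) = (⌊ 1 + s /2⌋ + 1) (⌈ 1 + s /2⌉ + 1) midChains (1 + s).
middle-growth : ∀ s → 3 * (suc ⌈ suc s /2⌉ * suc ⌊ suc s /2⌋) ≤ (3 + s) * (2 + s)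
middle-growth zero          = ≤-refl
middle-growth (suc zero)    = ≤-refl
middle-growth (suc (suc s)) = begin
  3 * (suc (suc v) * suc (suc u))
    ≡⟨ solve 2 (λ u v → con 3 :* ((con 2 :+ v) :* (con 2 :+ u))
                     := con 3 :* ((con 1 :+ v) :* (con 1 :+ u)) :+ con 3 :* (u :+ v) :+ con 9) refl u v ⟩
  3 * (suc v * suc u) + 3 * (u + v) + 9
    ≡⟨ cong (λ m → 3 * (suc v * suc u) + 3 * m + 9) (⌊n/2⌋+⌈n/2⌉≡n (suc s)) ⟩
  3 * (suc v * suc u) + 3 * suc s + 9
    ≤⟨ +-monoˡ-≤ 9 (+-monoˡ-≤ (3 * suc s) (middle-growth s)) ⟩
  (3 + s) * (2 + s) + 3 * suc s + 9
    ≤⟨ m≤m+n _ (2 + s) ⟩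
  (3 + s) * (2 + s) + 3 * suc s + 9 + (2 + s)
    ≡⟨ solve 1 (λ s → (con 3 :+ s) :* (con 2 :+ s) :+ con 3 :* (con 1 :+ s) :+ con 9 :+ (con 2 :+ s)
                   := (con 5 :+ s) :* (con 4 :+ s)) refl s ⟩
  (5 + s) * (4 + s)
    ∎
  where
  open ≤-Reasoning
  u = ⌊ suc s /2⌋
  v = ⌈ suc s /2⌉

midChains-ratio-base : ∀ s → 3 * midChains (3 + s) * suc s ! ≤ (3 + s) ! * midChains (suc s)
midChains-ratio-base s = begin
  3 * ((suc u * u !) * (suc v * v !)) * suc s !
    ≡⟨ solve 5 (λ u v U V F → con 3 :* (((con 1 :+ u) :* U) :* ((con 1 :+ v) :* V)) :* F
                           := (con 3 :* ((con 1 :+ v) :* (con 1 :+ u))) :* ((U :* V) :* F)) refl u v (u !) (v !) (suc s !) ⟩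
  3 * (suc v * suc u) * (midChains (suc s) * suc s !)
    ≤⟨ *-monoˡ-≤ _ (middle-growth s) ⟩
  (3 + s) * (2 + s) * (midChains (suc s) * suc s !)
    ≡⟨ solve 3 (λ s W F → (con 3 :+ s) :* (con 2 :+ s) :* (W :* F)
                       := ((con 3 :+ s) :* ((con 2 :+ s) :* F)) :* W) refl s (midChains (suc s)) (suc s !) ⟩
  (3 + s) ! * midChains (suc s)
    ∎
  where
  open ≤-Reasoning
  u = ⌊ suc s /2⌋
  v = ⌈ suc s /2⌉

midChains-ratio-step : ∀ s N → 3 * midChains N * s ! ≤ N ! * midChains s →
                       3 * midChains (suc N) * s ! ≤ suc N ! * midChains s
midChains-ratio-step s N ih = begin
  3 * midChains (suc N) * s !              ≡⟨ cong (λ m → 3 * m * s !) (midChains-suc N) ⟩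
  3 * (suc ⌊ N /2⌋ * midChains N) * s !     ≡⟨ solve 3 (λ h W F → con 3 :* ((con 1 :+ h) :* W) :* F
                                                 := (con 1 :+ h) :* (con 3 :* W :* F)) refl ⌊ N /2⌋ (midChains N) (s !) ⟩
  suc ⌊ N /2⌋ * (3 * midChains N * s !)     ≤⟨ *-mono-≤ (s≤s (⌊n/2⌋≤n N)) ih ⟩
  suc N * (N ! * midChains s)              ≡⟨ *-assoc (suc N) (N !) _ ⟨
  suc N ! * midChains s                    ∎
  where open ≤-Reasoning

midChains-ratio : ∀ s d → 1 ≤ s + d → 3 * midChains (d + (2 + s)) * s ! ≤ (d + (2 + s)) ! * midChains s
midChains-ratio (suc s) zero          _ = midChains-ratio-base s
midChains-ratio zero    (suc zero)    _ = ≤-refl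
midChains-ratio zero    (suc (suc d)) _ =
  midChains-ratio-step 0 (suc d + 2) (midChains-ratio zero (suc d) (s≤s z≤n))
midChains-ratio (suc s) (suc d)       _ =
  midChains-ratio-step (suc s) (d + (2 + suc s)) (midChains-ratio (suc s) d (s≤s z≤n))

three-midChains≤ : ∀ n a t → 2 + (a + t) ≤ n → 3 ≤ n → 3 * midChains n * (a + t) ! ≤ n ! * (a ! * t !)
three-midChains≤ n a t 2+a+t≤n 3≤n with m≤n⇒∃[o]m+o≡n 2+a+t≤n
... | d , refl = begin
  3 * midChains n * (a + t) !   ≡⟨ cong (λ m → 3 * midChains m * (a + t) !) n≡ ⟩
  3 * midChains (d + (2 + (a + t))) * (a + t) !
                               ≤⟨ midChains-ratio (a + t) d (≤-pred (≤-pred 3≤n)) ⟩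
  (d + (2 + (a + t))) ! * midChains (a + t)
                               ≡⟨ cong (λ m → m ! * midChains (a + t)) n≡ ⟨
  n ! * midChains (a + t)       ≤⟨ *-monoʳ-≤ (n !) (midChains≤ (a + t) a t refl) ⟩
  n ! * (a ! * t !)             ∎
  where
  open ≤-Reasoning
  n≡ : 2 + (a + t) + d ≡ d + (2 + (a + t))
  n≡ = +-comm (2 + (a + t)) d

midChains≤#chains-point : ∀ n (p : Subset n) → midChains n ≤ #chains n (interval p p)
midChains≤#chains-point n p = subst (midChains n ≤_) (sym #chains≡) (midChains≤ n ∣ p ∣ ∣ ∁ p ∣ (∣p∣+∣∁p∣≡n p))
  where
  #chains≡ : #chains n (interval p p) ≡ ∣ p ∣ ! * ∣ ∁ p ∣ !
  #chains≡ = *-cancelʳ-≡ _ _ (n !) {{n !≢0}} (begin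
    #chains n (interval p p) * n !                 ≡⟨ cong (λ m → #chains n (interval p p) * m !) (∣p∣+∣∁p∣≡n p) ⟨
    #chains n (interval p p) * (∣ p ∣ + ∣ ∁ p ∣) !  ≡⟨ #chains-interval n p p (⊆ᵇ-refl p) ⟩
    n ! * (∣ p ∣ ! * ∣ ∁ p ∣ !)                     ≡⟨ *-comm (n !) _ ⟩
    ∣ p ∣ ! * ∣ ∁ p ∣ ! * n !                       ∎)
    where open ≡-Reasoning

three-midChains≤#chains-interval : ∀ n (a c : Subset n) → a ⊆ᵇ c ≡ true → 2 + ∣ a ∣ ≤ ∣ c ∣ → 3 ≤ n →
                                   3 * midChains n ≤ #chains n (interval a c)
three-midChains≤#chains-interval n a c a⊆c 2+∣a∣≤∣c∣ 3≤n =
  *-cancelʳ-≤ (3 * midChains n) (#chains n (interval a c)) ((∣ a ∣ + ∣ ∁ c ∣) !) {{(∣ a ∣ + ∣ ∁ c ∣) !≢0}}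
    (subst (3 * midChains n * (∣ a ∣ + ∣ ∁ c ∣) ! ≤_) (sym (#chains-interval n a c a⊆c))
      (three-midChains≤ n ∣ a ∣ ∣ ∁ c ∣ levels 3≤n))
  where
  levels : 2 + (∣ a ∣ + ∣ ∁ c ∣) ≤ n
  levels = subst (2 + (∣ a ∣ + ∣ ∁ c ∣) ≤_) (∣p∣+∣∁p∣≡n c)
             (subst (_≤ ∣ c ∣ + ∣ ∁ c ∣) (+-assoc 2 ∣ a ∣ ∣ ∁ c ∣) (+-monoˡ-≤ ∣ ∁ c ∣ 2+∣a∣≤∣c∣))

-- Comparable pairs, convex hulls and the LYM bound

#P₂ᵇ : ∀ {n} → List (Subset n) → ℕ
#P₂ᵇ F = sumˡ (map (λ a → count (a ⊂ᵇ_) F) F)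

#P₂≡#P₂ᵇ : ∀ {n} (F : List (Subset n)) → #P₂ F ≡ #P₂ᵇ F
#P₂≡#P₂ᵇ {n} F = pairs F F
  where
  P? = λ (ab : Subset n × Subset n) → proj₁ ab ⊂? proj₂ ab
  row : ∀ (a : Subset n) bs → length (filter P? (map (a ,_) bs)) ≡ count (a ⊂ᵇ_) bs
  row a []       = refl
  row a (b ∷ bs) rewrite sym (does-⊂? a b) with does (a ⊂? b)
  ... | true  = cong suc (row a bs)
  ... | false = row a bs
  pairs : ∀ (as bs : List (Subset n)) →
          length (filter P? (cartesianProduct as bs)) ≡ sumˡ (map (λ a → count (a ⊂ᵇ_) bs) as)
  pairs []       bs = refl
  pairs (a ∷ as) bs = begin
    length (filter P? (map (a ,_) bs ++ cartesianProduct as bs))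
      ≡⟨ cong length (filter-++ P? (map (a ,_) bs) (cartesianProduct as bs)) ⟩
    length (filter P? (map (a ,_) bs) ++ filter P? (cartesianProduct as bs))
      ≡⟨ length-++ (filter P? (map (a ,_) bs)) ⟩
    length (filter P? (map (a ,_) bs)) + length (filter P? (cartesianProduct as bs))
      ≡⟨ cong₂ _+_ (row a bs) (pairs as bs) ⟩
    count (a ⊂ᵇ_) bs + sumˡ (map (λ a → count (a ⊂ᵇ_) bs) as)
      ∎
    where open ≡-Reasoning

hull : ∀ {n} → List (Subset n) → Subset n → Bool
hull L s = any (λ p → p ⊆ᵇ s ∧ any (s ⊆ᵇ_) L) L

hull-intro : ∀ {n} (L : List (Subset n)) {p q} s → p ∈ L → q ∈ L → p ⊆ᵇ s ≡ true → s ⊆ᵇ q ≡ true → hull L s ≡ true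
hull-intro L s p∈L q∈L p⊆s s⊆q = any-intro _ L p∈L (cong₂ _∧_ p⊆s (any-intro _ L q∈L s⊆q))

hull-elim : ∀ {n} (L : List (Subset n)) s → hull L s ≡ true →
            Σ (Subset n) λ p → Σ (Subset n) λ q → p ∈ L × q ∈ L × p ⊆ᵇ s ≡ true × s ⊆ᵇ q ≡ true
hull-elim L s e with any-elim _ L e
... | p , p∈L , e′ with p ⊆ᵇ s in p⊆s
...   | true with any-elim _ L e′
...     | q , q∈L , s⊆q = p , q , p∈L , q∈L , p⊆s , s⊆q

hull-mono : ∀ {n} (L L′ : List (Subset n)) → (∀ {x} → x ∈ L′ → x ∈ L) → ∀ s → hull L′ s ≡ true → hull L s ≡ true
hull-mono L L′ L′⊆L s e with hull-elim L′ s e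
... | p , q , p∈L′ , q∈L′ , p⊆s , s⊆q = hull-intro L s (L′⊆L p∈L′) (L′⊆L q∈L′) p⊆s s⊆q

Antichain : ∀ {n} → List (Subset n) → Set
Antichain L = ∀ {x y} → x ∈ L → y ∈ L → x ≢ y → x ⊆ᵇ y ≡ false

interval-point : ∀ {n} (p s : Subset n) → interval p p s ≡ true → s ≡ p
interval-point p s e with p ⊆ᵇ s in p⊆s | s ⊆ᵇ p in s⊆p
... | true | true = ⊆ᵇ-antisym s p s⊆p p⊆s

-- The LYM inequality in chain-counting form: every point of an antichain is met by
-- at least midChains n maximal chains, and no chain meets two of them.
midChains*length≤#chains : ∀ n (L : List (Subset n)) → Unique L → Antichain L →
                           midChains n * length L ≤ #chains n (λ s → any (λ a → interval a a s) L)
midChains*length≤#chains n []       _            _    = ≤-trans (≤-reflexive (*-zeroʳ (midChains n))) z≤n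
midChains*length≤#chains n (a ∷ L)  (a∉L ∷ uL)  anti = begin
  midChains n * suc (length L)                 ≡⟨ *-suc (midChains n) (length L) ⟩
  midChains n + midChains n * length L         ≤⟨ +-mono-≤ (midChains≤#chains-point n a)
                                                   (midChains*length≤#chains n L uL λ x∈ y∈ → anti (there x∈) (there y∈)) ⟩
  #chains n (interval a a) + #chains n (λ s → any (λ b → interval b b s) L)
                                               ≡⟨ #chains-∨ n (interval a a) _ incomparable ⟨
  #chains n (λ s → any (λ b → interval b b s) (a ∷ L))  ∎
  where
  open ≤-Reasoning
  incomparable : Incomparable (interval a a) (λ s → any (λ b → interval b b s) L)
  incomparable s t s∈ t∈ with interval-point a s s∈ | any-elim _ L t∈
  ... | refl | b , b∈L , t∈[b,b] with interval-point b t t∈[b,b]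
  ...   | refl = anti (here refl) (there b∈L) (All.lookup a∉L b∈L)
               , anti (there b∈L) (here refl) (All.lookup a∉L b∈L ∘ sym)

-- Decomposing N-free families

-- The other three disequalities of a copy of N follow from the strict inclusions.
N-freeᵇ : ∀ {n} → List (Subset n) → Set
N-freeᵇ L = ∀ {p₁ p₂ q₁ q₂} → p₁ ∈ L → p₂ ∈ L → q₁ ∈ L → q₂ ∈ L →
  p₁ ⊂ᵇ q₁ ≡ true → p₂ ⊂ᵇ q₁ ≡ true → p₂ ⊂ᵇ q₂ ≡ true → p₁ ≢ p₂ → p₁ ≢ q₂ → q₁ ≢ q₂ → ⊥

N-freeᵇ-⊆ : ∀ {n} (L L′ : List (Subset n)) → N-freeᵇ L → (∀ {x} → x ∈ L′ → x ∈ L) → N-freeᵇ L′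
N-freeᵇ-⊆ L L′ free L′⊆L p₁∈ p₂∈ q₁∈ q₂∈ = free (L′⊆L p₁∈) (L′⊆L p₂∈) (L′⊆L q₁∈) (L′⊆L q₂∈)

Separated : ∀ {n} → List (Subset n) → (Subset n → Bool) → Set
Separated L p = ∀ {a b} → a ∈ L → b ∈ L → p a ≡ true → p b ≡ false → (a ⊆ᵇ b ≡ false) × (b ⊆ᵇ a ≡ false)

separates : ∀ {n} {a b : Subset n} (p : Subset n → Bool) → p a ≡ true → p b ≡ false → a ≢ b
separates p pa pb refl with () ← trans (sym pa) pb

module _ {n} (L : List (Subset n)) (p : Subset n → Bool) (sep : Separated L p) where

  private
    K R : List (Subset n)
    K = filterᵇ p L
    R = filterᵇ (not ∘ p) L

    ∈K : ∀ {a} → a ∈ K → a ∈ L × p a ≡ true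
    ∈K = ∈-filterᵇ⁻ p L

    ∈R : ∀ {a} → a ∈ R → a ∈ L × p a ≡ false
    ∈R a∈R with ∈-filterᵇ⁻ (not ∘ p) L a∈R
    ... | a∈L , ¬pa = a∈L , not-injective ¬pa

  #P₂ᵇ-separated : #P₂ᵇ L ≡ #P₂ᵇ (filterᵇ p L) + #P₂ᵇ (filterᵇ (not ∘ p) L)
  #P₂ᵇ-separated = begin
    sumˡ (map (λ a → count (a ⊂ᵇ_) L) L)
      ≡⟨ sum-map-filterᵇ (λ a → count (a ⊂ᵇ_) L) p L ⟩
    sumˡ (map (λ a → count (a ⊂ᵇ_) L) K) + sumˡ (map (λ a → count (a ⊂ᵇ_) L) R)
      ≡⟨ cong₂ _+_ (sum-map-cong _ _ K above-in-K) (sum-map-cong _ _ R above-in-R) ⟩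
    #P₂ᵇ K + #P₂ᵇ R
      ∎
    where
    open ≡-Reasoning
    ⊂ᵇ-across : ∀ {a b} → a ∈ L → b ∈ L → p a ≡ true → p b ≡ false → a ⊂ᵇ b ≡ false × b ⊂ᵇ a ≡ false
    ⊂ᵇ-across a∈L b∈L pa pb with sep a∈L b∈L pa pb
    ... | a⊈b , b⊈a rewrite a⊈b | b⊈a = refl , refl
    above-in-K : ∀ {a} → a ∈ K → count (a ⊂ᵇ_) L ≡ count (a ⊂ᵇ_) K
    above-in-K {a} a∈K = trans (count-split (a ⊂ᵇ_) p L)
      (trans (cong (count (a ⊂ᵇ_) K +_) (count-none (a ⊂ᵇ_) R λ b∈R →
                proj₁ (⊂ᵇ-across (proj₁ (∈K a∈K)) (proj₁ (∈R b∈R)) (proj₂ (∈K a∈K)) (proj₂ (∈R b∈R)))))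
             (+-identityʳ _))
    above-in-R : ∀ {a} → a ∈ R → count (a ⊂ᵇ_) L ≡ count (a ⊂ᵇ_) R
    above-in-R {a} a∈R = trans (count-split (a ⊂ᵇ_) p L)
      (cong (_+ count (a ⊂ᵇ_) R) (count-none (a ⊂ᵇ_) K λ b∈K →
                proj₂ (⊂ᵇ-across (proj₁ (∈K b∈K)) (proj₁ (∈R a∈R)) (proj₂ (∈K b∈K)) (proj₂ (∈R a∈R)))))

  -- A comparability between the hulls would, by transitivity, give one between members
  -- on different sides.
  hull-separated : Incomparable (hull (filterᵇ p L)) (hull (filterᵇ (not ∘ p) L))
  hull-separated s t s∈ t∈ with hull-elim K s s∈ | hull-elim R t t∈
  ... | a , b , a∈K , b∈K , a⊆s , s⊆b | c , d , c∈R , d∈R , c⊆t , t⊆d = s⊈t , t⊈s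
    where
    s⊈t : s ⊆ᵇ t ≡ false
    s⊈t with s ⊆ᵇ t in s⊆t
    ... | false = refl
    ... | true with () ← trans (sym (⊆ᵇ-trans a s d a⊆s (⊆ᵇ-trans s t d s⊆t t⊆d)))
                          (proj₁ (sep (proj₁ (∈K a∈K)) (proj₁ (∈R d∈R)) (proj₂ (∈K a∈K)) (proj₂ (∈R d∈R))))
    t⊈s : t ⊆ᵇ s ≡ false
    t⊈s with t ⊆ᵇ s in t⊆s
    ... | false = refl
    ... | true with () ← trans (sym (⊆ᵇ-trans c t b c⊆t (⊆ᵇ-trans t s b t⊆s s⊆b)))
                          (proj₂ (sep (proj₁ (∈K b∈K)) (proj₁ (∈R c∈R)) (proj₂ (∈K b∈K)) (proj₂ (∈R c∈R))))

  #chains-hull-separated :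
    #chains n (hull (filterᵇ p L)) + #chains n (hull (filterᵇ (not ∘ p) L)) ≤ #chains n (hull L)
  #chains-hull-separated = subst (_≤ #chains n (hull L)) (#chains-∨ n (hull K) (hull R) hull-separated)
    (#chains-mono n _ _ λ s → hull-∨ s (hull K s) (hull R s) refl refl)
    where
    hull-∨ : ∀ s b c → hull K s ≡ b → hull R s ≡ c → b ∨ c ≡ true → hull L s ≡ true
    hull-∨ s true  _    s∈ _ _ = hull-mono L K (proj₁ ∘ ∈K) s s∈
    hull-∨ s false true _ s∈ _ = hull-mono L R (proj₁ ∘ ∈R) s s∈

minimal-element : ∀ {n} (x : Subset n) xs → Σ (Subset n) λ m → m ∈ x ∷ xs × (∀ {b} → b ∈ x ∷ xs → b ⊂ᵇ m ≡ false)
minimal-element x []       = x , here refl , λ { (here refl) → ⊂ᵇ-irrefl x }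
minimal-element x (y ∷ xs) with minimal-element y xs
... | m , m∈ , m-min with x ⊂ᵇ m in x⊂m
...   | false = m , there m∈ , λ { (here refl) → x⊂m ; (there b∈) → m-min b∈ }
...   | true  = x , here refl , x-min
  where
  x-min : ∀ {b} → b ∈ x ∷ y ∷ xs → b ⊂ᵇ x ≡ false
  x-min (here refl) = ⊂ᵇ-irrefl x
  x-min {b} (there b∈) with b ⊂ᵇ x in b⊂x
  ... | false = refl
  ... | true with () ← trans (sym (⊂ᵇ-trans b x m b⊂x x⊂m)) (m-min b∈)

BoundedPart : ∀ {n} → List (Subset n) → Subset n → Set
BoundedPart {n} L x = Σ (Subset n → Bool) λ p → p x ≡ true × Separated L p ×
  midChains n * #P₂ᵇ (filterᵇ p L) ≤ #chains n (hull (filterᵇ p L))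

antichain-bound : ∀ n (K D : List (Subset n)) → Unique D → Antichain D → (∀ {x} → x ∈ D → x ∈ K) →
                  #P₂ᵇ K ≤ length D → midChains n * #P₂ᵇ K ≤ #chains n (hull K)
antichain-bound n K D uD anti D⊆K #P₂≤ = begin
  midChains n * #P₂ᵇ K         ≤⟨ *-monoʳ-≤ (midChains n) #P₂≤ ⟩
  midChains n * length D       ≤⟨ midChains*length≤#chains n D uD anti ⟩
  #chains n (λ s → any (λ a → interval a a s) D)
                               ≤⟨ #chains-mono n _ _ points⊆hull ⟩
  #chains n (hull K)           ∎
  where
  open ≤-Reasoning
  points⊆hull : ∀ s → any (λ a → interval a a s) D ≡ true → hull K s ≡ true
  points⊆hull s e with any-elim _ D e
  ... | a , a∈D , s∈[a,a] with interval-point a s s∈[a,a]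
  ...   | refl = hull-intro K s (D⊆K a∈D) (D⊆K a∈D) (⊆ᵇ-refl s) (⊆ᵇ-refl s)

module Component {n} (L : List (Subset n)) (uL : Unique L) (free : N-freeᵇ L)
                 (x : Subset n) (x∈L : x ∈ L) (x-min : ∀ {b} → b ∈ L → b ⊂ᵇ x ≡ false) where

  private
    uK : (p : Subset n → Bool) → Unique (filterᵇ p L)
    uK p = Unique.filter⁺ (T? ∘ p) uL

    ∈K : ∀ (p : Subset n → Bool) {a} → a ∈ filterᵇ p L → a ∈ L × p a ≡ true
    ∈K p = ∈-filterᵇ⁻ p L

    U : List (Subset n)
    U = filterᵇ (x ⊂ᵇ_) L

    ⊂x-impossible : ∀ {b} → b ∈ L → b ⊆ᵇ x ≡ true → b ≢ x → ⊥
    ⊂x-impossible b∈L b⊆x b≢x with () ← trans (sym (⊆ᵇ∧≢⇒⊂ᵇ _ x b⊆x b≢x)) (x-min b∈L)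

    ⊉x⇒≢ : ∀ {a b} → x ⊆ᵇ a ≡ true → x ⊆ᵇ b ≡ false → b ≢ a
    ⊉x⇒≢ x⊆a x⊈b = separates (x ⊆ᵇ_) x⊆a x⊈b ∘ sym

    separated-above : (∀ {a b} → a ∈ L → b ∈ L → x ⊂ᵇ a ≡ true → b ⊂ᵇ a ≡ true → x ⊆ᵇ b ≡ false → ⊥) →
                      Separated L (x ⊆ᵇ_)
    separated-above no-crossing {a} {b} a∈L b∈L x⊆a x⊈b = a⊈b , b⊈a
      where
      a⊈b : a ⊆ᵇ b ≡ false
      a⊈b with a ⊆ᵇ b in a⊆b
      ... | false = refl
      ... | true with () ← trans (sym (⊆ᵇ-trans x a b x⊆a a⊆b)) x⊈b
      b⊈a : b ⊆ᵇ a ≡ false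
      b⊈a with b ⊆ᵇ a in b⊆a
      ... | false = refl
      ... | true with a ≟ˢ x
      ...   | yes refl = ⊥-elim (⊂x-impossible b∈L b⊆a (⊉x⇒≢ (⊆ᵇ-refl x) x⊈b))
      ...   | no  a≢x  = ⊥-elim (no-crossing a∈L b∈L (⊆ᵇ∧≢⇒⊂ᵇ x a x⊆a (a≢x ∘ sym))
                                                     (⊆ᵇ∧≢⇒⊂ᵇ b a b⊆a (⊉x⇒≢ x⊆a x⊈b)) x⊈b)

  -- The sets containing x form a star centred at x.
  up-star : (∀ {y z} → y ∈ L → x ⊂ᵇ y ≡ true → z ∈ L → y ⊂ᵇ z ≡ false) →
            (∀ {a} → a ∈ L → x ⊂ᵇ a ≡ true → Σ (Subset n) λ u → u ∈ L × x ⊂ᵇ u ≡ true × u ≢ a) →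
            BoundedPart L x
  up-star maximal another = (x ⊆ᵇ_) , ⊆ᵇ-refl x , separated , bound
    where
    K : List (Subset n)
    K = filterᵇ (x ⊆ᵇ_) L
    A : List (Subset n)
    A = filterᵇ (x ⊂ᵇ_) K
    separated : Separated L (x ⊆ᵇ_)
    separated = separated-above λ {a} {b} a∈L b∈L x⊂a b⊂a x⊈b → case another a∈L x⊂a of λ where
      (u , u∈L , x⊂u , u≢a) → free b∈L x∈L a∈L u∈L b⊂a x⊂a x⊂u
        (⊉x⇒≢ (⊆ᵇ-refl x) x⊈b) (⊉x⇒≢ (⊂ᵇ⇒⊆ᵇ x u x⊂u) x⊈b) (u≢a ∘ sym)
    maximal-in-K : ∀ {a b} → a ∈ K → a ≢ x → b ∈ K → a ⊂ᵇ b ≡ false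
    maximal-in-K a∈K a≢x b∈K with ∈K _ a∈K
    ... | a∈L , x⊆a = maximal a∈L (⊆ᵇ∧≢⇒⊂ᵇ x _ x⊆a (a≢x ∘ sym)) (proj₁ (∈K _ b∈K))
    antichain : Antichain A
    antichain {a} {b} a∈A b∈A a≢b with ∈-filterᵇ⁻ _ K a∈A | ∈-filterᵇ⁻ _ K b∈A
    ... | a∈K , x⊂a | b∈K , _ with a ⊆ᵇ b in a⊆b
    ...   | false = refl
    ...   | true with () ← trans (sym (⊆ᵇ∧≢⇒⊂ᵇ a b a⊆b a≢b)) (maximal-in-K a∈K (⊂ᵇ⇒≢ x a x⊂a ∘ sym) b∈K)
    pairs-from-x : #P₂ᵇ K ≤ length A
    pairs-from-x = sum-map-≤-at _≟ˢ_ (λ a → count (a ⊂ᵇ_) K) x K (uK _)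
      λ a∈K a≢x → count-none (_ ⊂ᵇ_) K (maximal-in-K a∈K a≢x)
    bound : midChains n * #P₂ᵇ K ≤ #chains n (hull K)
    bound = antichain-bound n K A (Unique.filter⁺ (T? ∘ (x ⊂ᵇ_)) (uK _)) antichain
              (proj₁ ∘ ∈-filterᵇ⁻ _ K) pairs-from-x

  -- The sets below y form a star centred at y.
  down-star : ∀ y → y ∈ L → x ⊂ᵇ y ≡ true → (∀ {b} → b ∈ L → x ⊂ᵇ b ≡ true → b ≡ y) →
              (∀ {z} → z ∈ L → y ⊂ᵇ z ≡ false) → BoundedPart L x
  down-star y y∈L x⊂y only-y y-max = (_⊆ᵇ y) , ⊂ᵇ⇒⊆ᵇ x y x⊂y , separated , bound
    where
    K : List (Subset n)
    K = filterᵇ (_⊆ᵇ y) L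
    D : List (Subset n)
    D = filterᵇ (λ a → not (does (a ≟ˢ y))) K
    above-below-y : ∀ {a b} → a ∈ L → b ∈ L → a ⊂ᵇ y ≡ true → a ⊂ᵇ b ≡ true → b ≡ y
    above-below-y {a} {b} a∈L b∈L a⊂y a⊂b with b ≟ˢ y | a ≟ˢ x
    ... | yes b≡y | _        = b≡y
    ... | no  _   | yes refl = only-y b∈L a⊂b
    ... | no  b≢y | no  a≢x with x ≟ˢ b
    ...   | yes refl with () ← trans (sym a⊂b) (x-min a∈L)
    ...   | no  x≢b = ⊥-elim (free x∈L a∈L y∈L b∈L x⊂y a⊂y a⊂b (a≢x ∘ sym) x≢b (b≢y ∘ sym))
    separated : Separated L (_⊆ᵇ y)
    separated {a} {b} a∈L b∈L a⊆y b⊈y = a⊈b , b⊈a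
      where
      b⊈a : b ⊆ᵇ a ≡ false
      b⊈a with b ⊆ᵇ a in b⊆a
      ... | false = refl
      ... | true with () ← trans (sym (⊆ᵇ-trans b a y b⊆a a⊆y)) b⊈y
      a⊈b : a ⊆ᵇ b ≡ false
      a⊈b with a ⊆ᵇ b in a⊆b
      ... | false = refl
      ... | true with a ≟ˢ y
      ...   | yes refl with () ← trans (sym (y-max b∈L)) (⊆ᵇ∧≢⇒⊂ᵇ y b a⊆b (separates (_⊆ᵇ y) a⊆y b⊈y))
      ...   | no  a≢y with above-below-y a∈L b∈L (⊆ᵇ∧≢⇒⊂ᵇ a y a⊆y a≢y) (⊆ᵇ∧≢⇒⊂ᵇ a b a⊆b (separates (_⊆ᵇ y) a⊆y b⊈y))
      ...     | refl with () ← trans (sym (⊆ᵇ-refl y)) b⊈y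
    ≢y : ∀ {a} → not (does (a ≟ˢ y)) ≡ true → a ≢ y
    ≢y {a} e with a ≟ˢ y | e
    ... | no a≢y | _ = a≢y
    antichain : Antichain D
    antichain {a} {b} a∈D b∈D a≢b with ∈-filterᵇ⁻ _ K a∈D | ∈-filterᵇ⁻ _ K b∈D
    ... | a∈K , a≢y | b∈K , b≢y with a ⊆ᵇ b in a⊆b
    ...   | false = refl
    ...   | true with ∈K _ a∈K | ∈K _ b∈K
    ...     | a∈L , a⊆y | b∈L , _ = ⊥-elim (≢y b≢y (above-below-y a∈L b∈L (⊆ᵇ∧≢⇒⊂ᵇ a y a⊆y (≢y a≢y))
                                                                      (⊆ᵇ∧≢⇒⊂ᵇ a b a⊆b a≢b)))
    indicator : Subset n → ℕ
    indicator a = if not (does (a ≟ˢ y)) then 1 else 0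
    at-most-one-above : ∀ {a} → a ∈ K → count (a ⊂ᵇ_) K ≤ indicator a
    at-most-one-above {a} a∈K with ∈K _ a∈K
    ... | a∈L , a⊆y with a ≟ˢ y
    ...   | yes refl = ≤-reflexive (count-none (y ⊂ᵇ_) K (y-max ∘ proj₁ ∘ ∈K _))
    ...   | no  a≢y  = count≤1 (a ⊂ᵇ_) y K (uK _) λ b∈K → above-below-y a∈L (proj₁ (∈K _ b∈K)) (⊆ᵇ∧≢⇒⊂ᵇ a y a⊆y a≢y)
    bound : midChains n * #P₂ᵇ K ≤ #chains n (hull K)
    bound = antichain-bound n K D (Unique.filter⁺ (T? ∘ _) (uK _)) antichain (proj₁ ∘ ∈-filterᵇ⁻ _ K)
      (≤-trans (sum-map-mono _ indicator K at-most-one-above) (≤-reflexive (sym (count≡sum-map _ K))))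

  -- The sets containing x carry at most three comparable pairs, and [x , z] spans two levels.
  triangle : 3 ≤ n → ∀ y z → y ∈ L → z ∈ L → x ⊂ᵇ y ≡ true → y ⊂ᵇ z ≡ true → BoundedPart L x
  triangle 3≤n y z y∈L z∈L x⊂y y⊂z = (x ⊆ᵇ_) , ⊆ᵇ-refl x , separated , bound
    where
    K : List (Subset n)
    K = filterᵇ (x ⊆ᵇ_) L
    x⊂z : x ⊂ᵇ z ≡ true
    x⊂z = ⊂ᵇ-trans x y z x⊂y y⊂z
    y-or-z : ∀ {a} → a ∈ L → x ⊂ᵇ a ≡ true → a ≡ y ⊎ a ≡ z
    y-or-z {a} a∈L x⊂a with a ≟ˢ y | a ≟ˢ z
    ... | yes a≡y | _       = inj₁ a≡y
    ... | no  _   | yes a≡z = inj₂ a≡z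
    ... | no  a≢y | no  a≢z = ⊥-elim (free y∈L x∈L z∈L a∈L y⊂z x⊂z x⊂a (⊂ᵇ⇒≢ x y x⊂y ∘ sym) (a≢y ∘ sym) (a≢z ∘ sym))
    separated : Separated L (x ⊆ᵇ_)
    separated = separated-above λ {a} {b} a∈L b∈L x⊂a b⊂a x⊈b → case y-or-z a∈L x⊂a of λ where
      (inj₁ refl) → free b∈L x∈L y∈L z∈L b⊂a x⊂y x⊂z
                      (⊉x⇒≢ (⊆ᵇ-refl x) x⊈b) (⊉x⇒≢ (⊂ᵇ⇒⊆ᵇ x z x⊂z) x⊈b) (⊂ᵇ⇒≢ y z y⊂z)
      (inj₂ refl) → free b∈L x∈L z∈L y∈L b⊂a x⊂z x⊂y
                      (⊉x⇒≢ (⊆ᵇ-refl x) x⊈b) (⊉x⇒≢ (⊂ᵇ⇒⊆ᵇ x y x⊂y) x⊈b) (⊂ᵇ⇒≢ y z y⊂z ∘ sym)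
    above-x : ∀ {a b} → a ∈ K → b ∈ L → a ⊂ᵇ b ≡ true → x ⊂ᵇ b ≡ true
    above-x {a} {b} a∈K b∈L a⊂b = ⊆ᵇ∧≢⇒⊂ᵇ x b (⊆ᵇ-trans x a b (proj₂ (∈K _ a∈K)) (⊂ᵇ⇒⊆ᵇ a b a⊂b))
      λ { refl → ⊂x-impossible (proj₁ (∈K _ a∈K)) (⊂ᵇ⇒⊆ᵇ a x a⊂b) (⊂ᵇ⇒≢ a x a⊂b) }
    pairs-from-x : count (x ⊂ᵇ_) K ≤ 2
    pairs-from-x = count≤2 (x ⊂ᵇ_) y z K (uK _) λ b∈K → y-or-z (proj₁ (∈K _ b∈K))
    pairs-from-y : count (y ⊂ᵇ_) K ≤ 1
    pairs-from-y = count≤1 (y ⊂ᵇ_) z K (uK _) λ {b} b∈K y⊂b →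
      [ (λ { refl → ⊥-elim (⊂ᵇ⇒≢ y y y⊂b refl) }) , id ]′ (y-or-z (proj₁ (∈K _ b∈K)) (⊂ᵇ-trans x y b x⊂y y⊂b))
    no-other-pairs : ∀ {a} → a ∈ K → a ≢ x → a ≢ y → count (a ⊂ᵇ_) K ≡ 0
    no-other-pairs {a} a∈K a≢x a≢y with y-or-z (proj₁ (∈K _ a∈K)) (⊆ᵇ∧≢⇒⊂ᵇ x a (proj₂ (∈K _ a∈K)) (a≢x ∘ sym))
    ... | inj₁ a≡y = ⊥-elim (a≢y a≡y)
    ... | inj₂ refl = count-none (z ⊂ᵇ_) K λ {b} b∈K → z-max b∈K
      where
      z-max : ∀ {b} → b ∈ K → z ⊂ᵇ b ≡ false
      z-max {b} b∈K with z ⊂ᵇ b in z⊂b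
      ... | false = refl
      ... | true with y-or-z (proj₁ (∈K _ b∈K)) (above-x a∈K (proj₁ (∈K _ b∈K)) z⊂b)
      ...   | inj₁ refl with () ← trans (sym z⊂b) (⊂ᵇ-asym y z y⊂z)
      ...   | inj₂ refl with () ← trans (sym z⊂b) (⊂ᵇ-irrefl z)
    at-most-three : #P₂ᵇ K ≤ 3
    at-most-three = ≤-trans (sum-map-≤-at₂ _≟ˢ_ _ x y K (uK _) no-other-pairs) (+-mono-≤ pairs-from-x pairs-from-y)
    x∈K : x ∈ K
    x∈K = ∈-filterᵇ⁺ (x ⊆ᵇ_) L x∈L (⊆ᵇ-refl x)
    z∈K : z ∈ K
    z∈K = ∈-filterᵇ⁺ (x ⊆ᵇ_) L z∈L (⊂ᵇ⇒⊆ᵇ x z x⊂z)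
    two-levels : 2 + ∣ x ∣ ≤ ∣ z ∣
    two-levels = ≤-trans (s≤s (⊂ᵇ⇒∣∣< x y x⊂y)) (⊂ᵇ⇒∣∣< y z y⊂z)
    bound : midChains n * #P₂ᵇ K ≤ #chains n (hull K)
    bound = begin
      midChains n * #P₂ᵇ K              ≤⟨ *-monoʳ-≤ (midChains n) at-most-three ⟩
      midChains n * 3                   ≡⟨ *-comm (midChains n) 3 ⟩
      3 * midChains n                   ≤⟨ three-midChains≤#chains-interval n x z (⊂ᵇ⇒⊆ᵇ x z x⊂z) two-levels 3≤n ⟩
      #chains n (interval x z)          ≤⟨ #chains-mono n _ _ [x,z]⊆hull ⟩
      #chains n (hull K)                ∎
      where
      open ≤-Reasoning
      [x,z]⊆hull : ∀ s → interval x z s ≡ true → hull K s ≡ true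
      [x,z]⊆hull s e with x ⊆ᵇ s in x⊆s | s ⊆ᵇ z in s⊆z
      ... | true | true = hull-intro K s x∈K z∈K x⊆s s⊆z

  bounded-part : 3 ≤ n → BoundedPart L x
  bounded-part 3≤n with any (λ y → any (y ⊂ᵇ_) L) U in some-chain
  ... | true with any-elim _ U some-chain
  ...   | y , y∈U , y-below with any-elim (y ⊂ᵇ_) L y-below | ∈-filterᵇ⁻ (x ⊂ᵇ_) L y∈U
  ...     | z , z∈L , y⊂z | y∈L , x⊂y = triangle 3≤n y z y∈L z∈L x⊂y y⊂z
  bounded-part 3≤n | false = by-size U refl
    where
    maximal : ∀ {y z} → y ∈ L → x ⊂ᵇ y ≡ true → z ∈ L → y ⊂ᵇ z ≡ false
    maximal {y} y∈L x⊂y z∈L = any-false (y ⊂ᵇ_) L (any-false _ U some-chain (∈-filterᵇ⁺ (x ⊂ᵇ_) L y∈L x⊂y)) z∈L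
    by-size : ∀ U′ → U′ ≡ U → BoundedPart L x
    by-size [] U≡ = up-star maximal λ a∈L x⊂a → case-empty (subst (_ ∈_) (sym U≡) (∈-filterᵇ⁺ (x ⊂ᵇ_) L a∈L x⊂a))
      where
      case-empty : ∀ {a} → a ∈ [] → Σ (Subset n) λ u → u ∈ L × x ⊂ᵇ u ≡ true × u ≢ a
      case-empty ()
    by-size (y ∷ []) U≡ = down-star y (proj₁ y∈) (proj₂ y∈) only-y (maximal (proj₁ y∈) (proj₂ y∈))
      where
      y∈ : y ∈ L × x ⊂ᵇ y ≡ true
      y∈ = ∈-filterᵇ⁻ (x ⊂ᵇ_) L (subst (y ∈_) U≡ (here refl))
      only-y : ∀ {b} → b ∈ L → x ⊂ᵇ b ≡ true → b ≡ y
      only-y b∈L x⊂b with subst (_ ∈_) (sym U≡) (∈-filterᵇ⁺ (x ⊂ᵇ_) L b∈L x⊂b)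
      ... | here b≡y = b≡y
    by-size (y₁ ∷ y₂ ∷ _) U≡ = up-star maximal another
      where
      y₁≢y₂ : y₁ ≢ y₂
      y₁≢y₂ with subst Unique (sym U≡) (Unique.filter⁺ (T? ∘ (x ⊂ᵇ_)) uL)
      ... | y₁∉ ∷ _ = All.head y₁∉
      y₁∈ : y₁ ∈ L × x ⊂ᵇ y₁ ≡ true
      y₁∈ = ∈-filterᵇ⁻ (x ⊂ᵇ_) L (subst (y₁ ∈_) U≡ (here refl))
      y₂∈ : y₂ ∈ L × x ⊂ᵇ y₂ ≡ true
      y₂∈ = ∈-filterᵇ⁻ (x ⊂ᵇ_) L (subst (y₂ ∈_) U≡ (there (here refl)))
      another : ∀ {a} → a ∈ L → x ⊂ᵇ a ≡ true → Σ (Subset n) λ u → u ∈ L × x ⊂ᵇ u ≡ true × u ≢ a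
      another {a} _ _ with a ≟ˢ y₁
      ... | yes refl = y₂ , proj₁ y₂∈ , proj₂ y₂∈ , y₁≢y₂ ∘ sym
      ... | no  a≢y₁ = y₁ , proj₁ y₁∈ , proj₂ y₁∈ , a≢y₁ ∘ sym

midChains*#P₂≤#chains-hull : ∀ {n} → 3 ≤ n → ∀ k (L : List (Subset n)) → length L ≤ k → Unique L → N-freeᵇ L →
                             midChains n * #P₂ᵇ L ≤ #chains n (hull L)
midChains*#P₂≤#chains-hull {n} _   _       []       _ _ _    = ≤-trans (≤-reflexive (*-zeroʳ (midChains n))) z≤n
midChains*#P₂≤#chains-hull {n} 3≤n (suc k) (a ∷ as) ∣L∣≤ uL free
  with minimal-element a as
... | x , x∈L , x-min with Component.bounded-part (a ∷ as) uL free x x∈L x-min 3≤n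
...   | p , px , sep , part-bound = begin
  midChains n * #P₂ᵇ L                              ≡⟨ cong (midChains n *_) (#P₂ᵇ-separated L p sep) ⟩
  midChains n * (#P₂ᵇ K + #P₂ᵇ R)                   ≡⟨ *-distribˡ-+ (midChains n) (#P₂ᵇ K) (#P₂ᵇ R) ⟩
  midChains n * #P₂ᵇ K + midChains n * #P₂ᵇ R       ≤⟨ +-mono-≤ part-bound rest-bound ⟩
  #chains n (hull K) + #chains n (hull R)           ≤⟨ #chains-hull-separated L p sep ⟩
  #chains n (hull L)                                ∎
  where
  open ≤-Reasoning
  L : List (Subset n)
  L = a ∷ as
  K R : List (Subset n)
  K = filterᵇ p L
  R = filterᵇ (not ∘ p) L
  ∣R∣≤k : length R ≤ k
  ∣R∣≤k = ≤-pred (≤-trans (filter-notAll (T? ∘ (not ∘ p)) L x∉R) ∣L∣≤)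
    where x∉R = Any.map (λ { refl ¬px → subst T (cong not px) ¬px }) x∈L
  rest-bound : midChains n * #P₂ᵇ R ≤ #chains n (hull R)
  rest-bound = midChains*#P₂≤#chains-hull 3≤n k R ∣R∣≤k (Unique.filter⁺ (T? ∘ (not ∘ p)) uL)
                 (N-freeᵇ-⊆ L R free (proj₁ ∘ ∈-filterᵇ⁻ (not ∘ p) L))

#P₂ᵇ≤binomial : ∀ {n} → 3 ≤ n → (L : List (Subset n)) → Unique L → N-freeᵇ L → #P₂ᵇ L ≤ n C (n / 2)
#P₂ᵇ≤binomial {n} 3≤n L uL free = *-cancelʳ-≤ (#P₂ᵇ L) (n C (n / 2)) (midChains n) {{midChains≢0 n}} (begin
  #P₂ᵇ L * midChains n         ≡⟨ *-comm (#P₂ᵇ L) (midChains n) ⟩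
  midChains n * #P₂ᵇ L         ≤⟨ midChains*#P₂≤#chains-hull 3≤n (length L) L ≤-refl uL free ⟩
  #chains n (hull L)           ≤⟨ #chains≤n! n (hull L) ⟩
  n !                          ≡⟨ binomial*midChains≡n! n ⟨
  (n C (n / 2)) * midChains n  ∎)
  where open ≤-Reasoning

quad : ∀ {A : Set} → A → A → A → A → Fin 4 → A
quad a b c d i = lookup (a ∷ b ∷ c ∷ d ∷ []) i

quad-injective : ∀ {A : Set} {a b c d : A} → a ≢ b → a ≢ c → a ≢ d → b ≢ c → b ≢ d → c ≢ d →
                 Injective _≡_ _≡_ (quad a b c d)
quad-injective a≢b a≢c a≢d b≢c b≢d c≢d {i} {j} = go i j
  where
  go : ∀ i j → quad _ _ _ _ i ≡ quad _ _ _ _ j → i ≡ j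
  go zero                   zero                   _ = refl
  go zero                   (suc zero)             e = ⊥-elim (a≢b e)
  go zero                   (suc (suc zero))       e = ⊥-elim (a≢c e)
  go zero                   (suc (suc (suc zero))) e = ⊥-elim (a≢d e)
  go (suc zero)             zero                   e = ⊥-elim (a≢b (sym e))
  go (suc zero)             (suc zero)             _ = refl
  go (suc zero)             (suc (suc zero))       e = ⊥-elim (b≢c e)
  go (suc zero)             (suc (suc (suc zero))) e = ⊥-elim (b≢d e)
  go (suc (suc zero))       zero                   e = ⊥-elim (a≢c (sym e))
  go (suc (suc zero))       (suc zero)             e = ⊥-elim (b≢c (sym e))
  go (suc (suc zero))       (suc (suc zero))       _ = refl
  go (suc (suc zero))       (suc (suc (suc zero))) e = ⊥-elim (c≢d e)
  go (suc (suc (suc zero))) zero                   e = ⊥-elim (a≢d (sym e))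
  go (suc (suc (suc zero))) (suc zero)             e = ⊥-elim (b≢d (sym e))
  go (suc (suc (suc zero))) (suc (suc zero))       e = ⊥-elim (c≢d (sym e))
  go (suc (suc (suc zero))) (suc (suc (suc zero))) _ = refl

N-free⇒N-freeᵇ : ∀ {n} (F : List (Subset n)) → N-free F → N-freeᵇ F
N-free⇒N-freeᵇ F N-free {p₁} {p₂} {q₁} {q₂} p₁∈ p₂∈ q₁∈ q₂∈ p₁⊂q₁ p₂⊂q₁ p₂⊂q₂ p₁≢p₂ p₁≢q₂ q₁≢q₂ =
  N-free (quad p₁ p₂ q₁ q₂ , injective , members , monotone)
  where
  injective : Injective _≡_ _≡_ (quad p₁ p₂ q₁ q₂)
  injective = quad-injective p₁≢p₂ (⊂ᵇ⇒≢ p₁ q₁ p₁⊂q₁) p₁≢q₂ (⊂ᵇ⇒≢ p₂ q₁ p₂⊂q₁) (⊂ᵇ⇒≢ p₂ q₂ p₂⊂q₂) q₁≢q₂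
  members : ∀ i → quad p₁ p₂ q₁ q₂ i ∈ F
  members zero                   = p₁∈
  members (suc zero)             = p₂∈
  members (suc (suc zero))       = q₁∈
  members (suc (suc (suc zero))) = q₂∈
  monotone : ∀ i j → N≤ i j → quad p₁ p₂ q₁ q₂ i ⊆ quad p₁ p₂ q₁ q₂ j
  monotone i .i (inj₁ refl)                        = ⊆-refl
  monotone _ _  (inj₂ (inj₁ (refl , refl)))        = ⊆ᵇ⇒⊆ p₁ q₁ (⊂ᵇ⇒⊆ᵇ p₁ q₁ p₁⊂q₁)
  monotone _ _  (inj₂ (inj₂ (inj₁ (refl , refl)))) = ⊆ᵇ⇒⊆ p₂ q₁ (⊂ᵇ⇒⊆ᵇ p₂ q₁ p₂⊂q₁)
  monotone _ _  (inj₂ (inj₂ (inj₂ (refl , refl)))) = ⊆ᵇ⇒⊆ p₂ q₂ (⊂ᵇ⇒⊆ᵇ p₂ q₂ p₂⊂q₂)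

-- N is the path poset p₁ < q₁ > p₂ < q₂, i.e. Path≤ (true ∷ false ∷ true ∷ []).
𝒫₄-free⇒N-freeᵇ : ∀ {n} (F : List (Subset n)) → 𝒫₄-free F → N-freeᵇ F
𝒫₄-free⇒N-freeᵇ {n} F 𝒫₄-free {p₁} {p₂} {q₁} {q₂} p₁∈ p₂∈ q₁∈ q₂∈ p₁⊂q₁ p₂⊂q₁ p₂⊂q₂ p₁≢p₂ p₁≢q₂ q₁≢q₂ =
  𝒫₄-free (true ∷ false ∷ true ∷ [])
    (g , injective , members , λ _ _ → fold (λ i j → g i ⊆ g j) (λ e → ⊆-trans (edge e)) ⊆-refl)
  where
  g : Fin 4 → Subset n
  g = quad p₁ q₁ p₂ q₂
  injective : Injective _≡_ _≡_ g
  injective = quad-injective (⊂ᵇ⇒≢ p₁ q₁ p₁⊂q₁) p₁≢p₂ p₁≢q₂ (⊂ᵇ⇒≢ p₂ q₁ p₂⊂q₁ ∘ sym) q₁≢q₂ (⊂ᵇ⇒≢ p₂ q₂ p₂⊂q₂)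
  members : ∀ i → g i ∈ F
  members zero                   = p₁∈
  members (suc zero)             = q₁∈
  members (suc (suc zero))       = p₂∈
  members (suc (suc (suc zero))) = q₂∈
  edge : ∀ {a b} → PathEdge (true ∷ false ∷ true ∷ []) a b → g a ⊆ g b
  edge (zero ,             inj₁ (_ , refl , refl)) = ⊆ᵇ⇒⊆ p₁ q₁ (⊂ᵇ⇒⊆ᵇ p₁ q₁ p₁⊂q₁)
  edge (suc zero ,         inj₂ (_ , refl , refl)) = ⊆ᵇ⇒⊆ p₂ q₁ (⊂ᵇ⇒⊆ᵇ p₂ q₁ p₂⊂q₁)
  edge (suc (suc zero) ,   inj₁ (_ , refl , refl)) = ⊆ᵇ⇒⊆ p₂ q₂ (⊂ᵇ⇒⊆ᵇ p₂ q₂ p₂⊂q₂)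
  edge (zero ,             inj₂ (() , _))
  edge (suc zero ,         inj₁ (() , _))
  edge (suc (suc zero) ,   inj₂ (() , _))

-- The extremal family

level : ∀ n → ℕ → List (Subset n)
level zero    zero    = [] ∷ []
level zero    (suc k) = []
level (suc n) zero    = ∅ ∷ []
level (suc n) (suc k) = map (true ∷_) (level n k) ++ map (false ∷_) (level n (suc k))

length-level : ∀ n k → length (level n k) ≡ n C k
length-level zero    zero    = refl
length-level zero    (suc k) = refl
length-level (suc n) zero    = refl
length-level (suc n) (suc k) = begin
  length (map (true ∷_) (level n k) ++ map (false ∷_) (level n (suc k)))
    ≡⟨ length-++ (map (true ∷_) (level n k)) ⟩
  length (map (true ∷_) (level n k)) + length (map (false ∷_) (level n (suc k)))
    ≡⟨ cong₂ _+_ (length-map (true ∷_) (level n k)) (length-map (false ∷_) (level n (suc k))) ⟩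
  length (level n k) + length (level n (suc k))
    ≡⟨ cong₂ _+_ (length-level n k) (length-level n (suc k)) ⟩
  n C k + n C suc k
    ≡⟨ nCk+nC[k+1]≡[n+1]C[k+1] n k ⟩
  suc n C suc k
    ∎
  where open ≡-Reasoning

∣∣-level : ∀ n k {x} → x ∈ level n k → ∣ x ∣ ≡ k
∣∣-level zero    zero    (here refl) = refl
∣∣-level (suc n) zero    (here refl) = ∣⊥∣≡0 (suc n)
∣∣-level (suc n) (suc k) x∈ with ∈-++⁻ (map (true ∷_) (level n k)) x∈
... | inj₁ x∈₁ with ∈-map⁻ (true ∷_) x∈₁
...   | y , y∈ , refl = cong suc (∣∣-level n k y∈)
∣∣-level (suc n) (suc k) x∈ | inj₂ x∈₂ with ∈-map⁻ (false ∷_) x∈₂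
...   | y , y∈ , refl = ∣∣-level n (suc k) y∈

level-unique : ∀ n k → Unique (level n k)
level-unique zero    zero    = All.[] ∷ []
level-unique zero    (suc k) = []
level-unique (suc n) zero    = All.[] ∷ []
level-unique (suc n) (suc k) = Unique.++⁺ (Unique.map⁺ ∷-injectiveʳ (level-unique n k))
                                          (Unique.map⁺ ∷-injectiveʳ (level-unique n (suc k))) disjoint
  where
  disjoint : ∀ {v} → ¬ (v ∈ map (true ∷_) (level n k) × v ∈ map (false ∷_) (level n (suc k)))
  disjoint (v∈₁ , v∈₂) with ∈-map⁻ (true ∷_) v∈₁ | ∈-map⁻ (false ∷_) v∈₂
  ... | _ , _ , refl | _ , _ , ()

inject₁≢suc : ∀ {m} (i : Fin m) → inject₁ i ≢ suc i
inject₁≢suc i e = <-irrefl (trans (sym (toℕ-inject₁ i)) (cong toℕ e)) ≤-refl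

-- ∅ together with a full level k ≥ 1. Its only comparable pairs are
-- ∅ ⊂ x, and since ∅ is the unique non-maximal member it contains no N and no path of length 3.
module Extremal (n k : ℕ) (1≤k : 1 ≤ k) where

  F : List (Subset n)
  F = ∅ ∷ level n k

  ∅∉level : ∀ {x} → x ∈ level n k → ∅ ≢ x
  ∅∉level x∈ ∅≡x = <-irrefl (trans (sym (∣⊥∣≡0 n)) (trans (cong ∣_∣ ∅≡x) (∣∣-level n k x∈))) 1≤k

  unique : Unique F
  unique = All.tabulate ∅∉level ∷ level-unique n k

  below-is-∅ : ∀ {a b} → a ∈ F → b ∈ F → a ⊆ᵇ b ≡ true → a ≢ b → a ≡ ∅
  below-is-∅ (here refl) _           _   _   = refl
  below-is-∅ (there _)   (here refl) a⊆∅ _   = ⊆ᵇ-∅ _ a⊆∅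
  below-is-∅ (there a∈)  (there b∈)  a⊆b a≢b =
    ⊥-elim (a≢b (⊆ᵇ-∣∣-≡ _ _ a⊆b (trans (∣∣-level n k a∈) (sym (∣∣-level n k b∈)))))

  #P₂ᵇ-F : #P₂ᵇ F ≡ length (level n k)
  #P₂ᵇ-F rewrite ⊂ᵇ-irrefl (∅ {n}) = trans
    (cong₂ _+_ (count-all (∅ ⊂ᵇ_) (level n k) λ {x} x∈ → ⊆ᵇ∧≢⇒⊂ᵇ ∅ x (∅-⊆ᵇ x) (∅∉level x∈))
               (sum-map-none _ (level n k) λ a∈ → count-none (_ ⊂ᵇ_) F (top a∈)))
    (+-identityʳ _)
    where
    top : ∀ {a b} → a ∈ level n k → b ∈ F → a ⊂ᵇ b ≡ false
    top {a} {b} a∈ b∈ with a ⊂ᵇ b in a⊂b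
    ... | false = refl
    ... | true with below-is-∅ (there a∈) b∈ (⊂ᵇ⇒⊆ᵇ a b a⊂b) (⊂ᵇ⇒≢ a b a⊂b)
    ...   | refl = ⊥-elim (∅∉level a∈ refl)

  -- Every non-maximal element of an embedded poset is sent to ∅, so there is at most one.
  embedded-below-is-∅ : ∀ {k′} {f : Fin k′ → Subset n} → Injective _≡_ _≡_ f → (∀ i → f i ∈ F) →
                ∀ {i j} → f i ⊆ f j → i ≢ j → f i ≡ ∅
  embedded-below-is-∅ inj mem fi⊆fj i≢j = below-is-∅ (mem _) (mem _) (⊆⇒⊆ᵇ _ _ fi⊆fj) (i≢j ∘ inj)

  N-free-F : N-free F
  N-free-F (f , inj , mem , mono) = case inj (trans p₁↦∅ (sym p₂↦∅)) of λ ()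
    where
    p₁↦∅ : f zero ≡ ∅
    p₁↦∅ = embedded-below-is-∅ inj mem (mono _ _ (inj₂ (inj₁ (refl , refl)))) λ ()
    p₂↦∅ : f (suc zero) ≡ ∅
    p₂↦∅ = embedded-below-is-∅ inj mem (mono _ _ (inj₂ (inj₂ (inj₁ (refl , refl))))) λ ()

  𝒫₄-free-F : 𝒫₄-free F
  -- The disjoint edges 0 - 1 and 2 - 3 would both have an end mapped to ∅.
  𝒫₄-free-F o (f , inj , mem , mono) = two-∅ (edge-end zero) (edge-end (suc (suc zero)))
    where
    edge-end : ∀ (i : Fin 3) → f (inject₁ i) ≡ ∅ ⊎ f (suc i) ≡ ∅
    edge-end i with lookup o i in oi
    ... | true  = inj₁ (embedded-below-is-∅ inj mem (mono _ _ ((i , inj₁ (oi , refl , refl)) ◅ ε)) (inject₁≢suc i))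
    ... | false = inj₂ (embedded-below-is-∅ inj mem (mono _ _ ((i , inj₂ (oi , refl , refl)) ◅ ε)) (inject₁≢suc i ∘ sym))
    two-∅ : f zero ≡ ∅ ⊎ f (suc zero) ≡ ∅ → f (suc (suc zero)) ≡ ∅ ⊎ f (suc (suc (suc zero))) ≡ ∅ → ⊥
    two-∅ (inj₁ e) (inj₁ e′) with () ← inj (trans e (sym e′))
    two-∅ (inj₁ e) (inj₂ e′) with () ← inj (trans e (sym e′))
    two-∅ (inj₂ e) (inj₁ e′) with () ← inj (trans e (sym e′))
    two-∅ (inj₂ e) (inj₂ e′) with () ← inj (trans e (sym e′))

theorem5 : ∀ (n : ℕ) → 3 ≤ n →
    La#P₂≡ n N-free (n C (n / 2)) × La#P₂≡ n 𝒫₄-free (n C (n / 2))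
theorem5 n 3≤n = (upper N-free⇒N-freeᵇ , F , unique , N-free-F , #P₂-F)
               , (upper 𝒫₄-free⇒N-freeᵇ , F , unique , 𝒫₄-free-F , #P₂-F)
  where
  open Extremal n (n / 2) (m≥n⇒m/n>0 {n} {2} (≤-trans (n≤1+n 2) 3≤n))
  upper : ∀ {Free : List (Subset n) → Set} → (∀ F → Free F → N-freeᵇ F) →
          ∀ F → Unique F → Free F → #P₂ F ≤ n C (n / 2)
  upper N-freeᵇ-of F uF free =
    subst (_≤ n C (n / 2)) (sym (#P₂≡#P₂ᵇ F)) (#P₂ᵇ≤binomial 3≤n F uF (N-freeᵇ-of F free))
  #P₂-F : #P₂ F ≡ n C (n / 2)
  #P₂-F = trans (#P₂≡#P₂ᵇ F) (trans #P₂ᵇ-F (length-level n (n / 2)))
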